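{- For integers $r\ge1$, $k\ge1$ let $L_r(k)=\#\{n\in\mathbb{N}: f_r\le n<f_{r+1},\ F(n)=k\}$. Then for $r\ge2k$ the number $L_r(k)$ does not depend on $r$. Denoting this common value by $L(k)=\lim_{r\to\infty}L_r(k)$, we have $L(1)=1$ and $L(k)=2\Psi(k)$ for $k>1$.
   Context: $f_0=f_1=1$, $f_i=f_{i-1}+f_{i-2}$ ($i\ge2$). A Fibonacci partition of $n\in\mathbb{N}$ is a finite set $\{f_{i_1},\dots,f_{i_h}\}$ with $1\le i_1<\dots<i_h$ and $f_{i_1}+\dots+f_{i_h}=n$; $F(n)$ is the number of Fibonacci partitions of $n$. The function $\Psi:\mathbb{N}_{\ge1}\to\mathbb{N}$ is defined by $\Psi(1)=1$ and $\Psi(k)=\sum_{1<r\le k,\ r\mid k}\Psi(k/r)\varphi(r)$ for $k\ge2$, with $\varphi$ Euler's totient function (equivalently, $\Psi(k)$ is the number of finite sequences $(a_1/b_1,\dots,a_s/b_s)$ of reduced fractions in $(0,1)$ with $b_1\cdots b_s=k$). -}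

module Defs where

open import Data.Nat using (ℕ; zero; suc; _+_; _*_; _∸_; _≤?_; _≟_; _/_)
open import Data.Nat.Divisibility using (_∣?_)
open import Data.Nat.GCD using (gcd)
open import Data.List using (List; []; _∷_; map; upTo; filter; length)
open import Data.Nat.ListAction using (sum)
open import Relation.Nullary.Decidable using (does)
open import Data.Bool using (if_then_else_)
open import Relation.Nullary using (yes; no)

fib : ℕ → ℕ
fib zero = 1
fib (suc zero) = 1
fib (suc (suc i)) = fib (suc i) + fib i

-- countSub m n = number of subsets S ⊆ {1,…,m} with Σ_{i∈S} fib i = n
countSub : ℕ → ℕ → ℕ
countSub zero n = if does (n ≟ 0) then 1 else 0
countSub (suc m) n =
  countSub m n + (if does (fib (suc m) ≤? n) then countSub m (n ∸ fib (suc m)) else 0)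

-- F n = number of Fibonacci partitions of n.  Since fib i ≥ i for i ≥ 1,
-- any index occurring in a Fibonacci partition of n is ≤ n, so subsets of
-- {1,…,n} suffice.
F : ℕ → ℕ
F n = countSub n n

range : ℕ → ℕ → List ℕ
range a b = map (a +_) (upTo (b ∸ a))

L : ℕ → ℕ → ℕ
L r k = length (filter (λ n → F n ≟ k) (range (fib r) (fib (suc r))))

φ : ℕ → ℕ
φ r = length (filter (λ i → gcd i r ≟ 1) (range 1 (suc r)))

-- Ψ with fuel: Ψ(1) = 1, Ψ(k) = Σ_{1<r≤k, r∣k} Ψ(k/r) φ(r).
-- Fuel k suffices since k/r < k for r > 1.
Ψ-fuel : ℕ → ℕ → ℕ
Ψ-fuel zero k = 0
Ψ-fuel (suc f) k with k ≟ 1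
... | yes _ = 1
... | no _ =
  sum (map (λ r → if does (r ∣? k) then Ψ-fuel f (k / suc (r ∸ 1)) * φ r else 0)
           (range 2 (suc k)))

Ψ : ℕ → ℕ
Ψ k = Ψ-fuel k k

-- For fib r ≤ n < fib (r + 1), the Fibonacci partitions of n either contain fib r or avoid it,
-- F n = X n + Y n. On the sub-block starting at fib r + fib (j + 1), a weighted count u X + α Y
-- becomes, depending on the parity of r − j, either the weighted count of a lower block for the
-- pair (u + i α, u + (i + 1) α), or (u + (i + 1) α) F. Counting the n of weight k therefore obeys
-- a recursion K along a tree of pairs (u, α) in which every coprime pair occurs exactly once.
-- Unfolding it from the root (1, 1), once r ≥ 2 k each coprime pair with u + α ≤ k contributes
-- Σ_i 2 Ψ (k / q) over the q = u + (i + 1) α dividing k (by induction on k), independently of r.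
-- Grouping by q, the coprime pairs with a given q are counted by φ q, which yields the
-- recursion Σ_{q ∣ k, q > 1} 2 Ψ (k / q) φ q = 2 Ψ k.

module Submission where

open import Defs
open import Data.Nat using (ℕ; zero; suc; _+_; _*_; _∸_; _≤_; _<_; z≤n; s≤s; _≤?_; _≟_; _/_; _<?_; _⊔_; ⌊_/2⌋)
open import Data.Nat.Properties
open import Data.Nat.DivMod using
    (_%_; m≡m%n+[m/n]*n; m%n<n; +-distrib-/; m<n⇒m/n≡0; m<n⇒m%n≡m; m*n/n≡m; m*n%n≡0; m/n<m; n/n≡1)
open import Data.Nat.Divisibility using (_∣_; _∣?_; divides; ∣-antisym; ∣m∣n⇒∣m+n; ∣m+n∣m⇒∣n; ∣-refl; ∣⇒≤)
open import Data.Nat.GCD using (gcd; gcd-comm; gcd-greatest; gcd[m,n]∣m; gcd[m,n]∣n)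
open import Data.Nat.ListAction using (sum)
open import Data.Bool using (Bool; true; false; if_then_else_)
open import Data.Empty using (⊥-elim)
open import Data.List using (_∷_; map; filter; length; applyUpTo)
open import Data.List.Properties using (map-upTo)
open import Data.Product using (_×_; _,_; proj₁; proj₂)
open import Data.Sum using (_⊎_; inj₁; inj₂)
open import Function using (_∘_)
open import Relation.Binary.PropositionalEquality
open import Relation.Nullary
open import Relation.Nullary.Decidable using (does; _×-dec_; decidable-stable)
open import Data.Nat.Tactic.RingSolver

-- Finite sums and indicators

Σ< : ℕ → (ℕ → ℕ) → ℕ
Σ< zero f = 0
Σ< (suc n) f = Σ< n f + f n

𝟙 : Bool → ℕ
𝟙 true = 1
𝟙 false = 0

if-yes : ∀ {A : Set} {P : Set} (d : Dec P) (a b : A) → P → (if does d then a else b) ≡ a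
if-yes (yes _) a b p = refl
if-yes (no ¬p) a b p = ⊥-elim (¬p p)

if-no : ∀ {A : Set} {P : Set} (d : Dec P) (a b : A) → ¬ P → (if does d then a else b) ≡ b
if-no (yes p) a b ¬p = ⊥-elim (¬p p)
if-no (no _) a b _ = refl

if-case : ∀ {A : Set} {P : Set} (d : Dec P) {a b x : A} → (P → a ≡ x) → (¬ P → b ≡ x) →
    (if does d then a else b) ≡ x
if-case (yes p) f g = f p
if-case (no ¬p) f g = g ¬p

if-cong : ∀ {A : Set} {P : Set} (d : Dec P) {a b c : A} → (P → a ≡ b) → (if does d then a else c) ≡
    (if does d then b else c)
if-cong (yes p) f = f p
if-cong (no _) f = refl

dec-elim : ∀ {P : Set} {X : Set} → Dec P → (P → X) → (¬ P → X) → X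
dec-elim (yes p) f g = f p
dec-elim (no ¬p) f g = g ¬p

𝟙-yes : ∀ {P : Set} (d : Dec P) → P → 𝟙 (does d) ≡ 1
𝟙-yes (yes _) _ = refl
𝟙-yes (no ¬p) p = ⊥-elim (¬p p)

𝟙-no : ∀ {A : Set} (d : Dec A) → ¬ A → 𝟙 (does d) ≡ 0
𝟙-no (yes a) ¬a = ⊥-elim (¬a a)
𝟙-no (no _) _ = refl

𝟙-cong-⇔ : ∀ {A B : Set} (d1 : Dec A) (d2 : Dec B) → (A → B) → (B → A) → 𝟙 (does d1) ≡ 𝟙 (does d2)
𝟙-cong-⇔ (yes a) (yes b) f g = refl
𝟙-cong-⇔ (yes a) (no ¬b) f g = ⊥-elim (¬b (f a))
𝟙-cong-⇔ (no ¬a) (yes b) f g = ⊥-elim (¬a (g b))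
𝟙-cong-⇔ (no ¬a) (no ¬b) f g = refl

if-+ : ∀ b (x y : ℕ) → (if b then x else 0) + (if b then y else 0) ≡ (if b then x + y else 0)
if-+ true x y = refl
if-+ false x y = refl

split-if : ∀ b (x : ℕ) → x ≡ (if b then 0 else x) + (if b then x else 0)
split-if true x = refl
split-if false x = sym (+-identityʳ x)

if-if-comm : ∀ (a b : Bool) (x : ℕ) → (if a then (if b then x else 0) else 0) ≡
    (if b then (if a then x else 0) else 0)
if-if-comm true true x = refl
if-if-comm true false x = refl
if-if-comm false true x = refl
if-if-comm false false x = refl

if-if-* : ∀ (a b : Bool) x → (if a then (if b then x else 0) else 0) ≡ x * (if a then 𝟙 b else 0)
if-if-* true true x = sym (*-identityʳ x)
if-if-* true false x = sym (*-zeroʳ x)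
if-if-* false b x = sym (*-zeroʳ x)

*-if : ∀ c (b : Bool) x → c * (if b then x else 0) ≡ (if b then c * x else 0)
*-if c true x = refl
*-if c false x = *-zeroʳ c

if-* : ∀ (b : Bool) y z → (if b then y else 0) * z ≡ (if b then y * z else 0)
if-* true y z = refl
if-* false y z = refl

Σ-cong : ∀ n {f g : ℕ → ℕ} → (∀ i → i < n → f i ≡ g i) → Σ< n f ≡ Σ< n g
Σ-cong zero h = refl
Σ-cong (suc n) h = cong₂ _+_ (Σ-cong n (λ i p → h i (m<n⇒m<1+n p))) (h n ≤-refl)

Σ-zero : ∀ n {f : ℕ → ℕ} → (∀ i → i < n → f i ≡ 0) → Σ< n f ≡ 0
Σ-zero zero h = refl
Σ-zero (suc n) h = cong₂ _+_ (Σ-zero n (λ i p → h i (m<n⇒m<1+n p))) (h n ≤-refl)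

Σ-distrib-+ : ∀ n (f g : ℕ → ℕ) → Σ< n (λ i → f i + g i) ≡ Σ< n f + Σ< n g
Σ-distrib-+ zero f g = refl
Σ-distrib-+ (suc n) f g rewrite Σ-distrib-+ n f g = +-assoc-swap (Σ< n f) (Σ< n g) (f n) (g n)
  where
  +-assoc-swap : ∀ a b c d → a + b + (c + d) ≡ a + c + (b + d)
  +-assoc-swap = solve-∀

Σ-split : ∀ m n (f : ℕ → ℕ) → Σ< (m + n) f ≡ Σ< m f + Σ< n (λ i → f (m + i))
Σ-split m zero f rewrite +-identityʳ m = sym (+-identityʳ _)
Σ-split m (suc n) f rewrite +-suc m n | Σ-split m n f = +-assoc (Σ< m f) _ _

Σ-head : ∀ n (f : ℕ → ℕ) → Σ< (suc n) f ≡ f 0 + Σ< n (λ i → f (suc i))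
Σ-head n f = Σ-split 1 n f

Σ-head⁺ : ∀ n (f : ℕ → ℕ) → 1 ≤ n → Σ< n f ≡ f 0 + Σ< (n ∸ 1) (λ i → f (suc i))
Σ-head⁺ (suc n) f _ = Σ-head n f

Σ-comm : ∀ m n (f : ℕ → ℕ → ℕ) → Σ< m (λ i → Σ< n (λ j → f i j)) ≡ Σ< n (λ j → Σ< m (λ i → f i j))
Σ-comm zero n f = sym (Σ-zero n (λ _ _ → refl))
Σ-comm (suc m) n f rewrite Σ-comm m n f = sym (Σ-distrib-+ n (λ j → Σ< m (λ i → f i j)) (λ j → f m j))

Σ-*ˡ : ∀ n c (f : ℕ → ℕ) → c * Σ< n f ≡ Σ< n (λ i → c * f i)
Σ-*ˡ zero c f = *-zeroʳ c
Σ-*ˡ (suc n) c f rewrite *-distribˡ-+ c (Σ< n f) (f n) | Σ-*ˡ n c f = refl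

Σ-single : ∀ n (f : ℕ → ℕ) i0 → i0 < n → (∀ i → i < n → i ≢ i0 → f i ≡ 0) → Σ< n f ≡ f i0
Σ-single zero f i0 () h
Σ-single (suc n) f i0 p h with i0 ≟ n
... | yes refl = trans (cong (_+ f n) (Σ-zero n (λ i q → h i (m<n⇒m<1+n q) (λ e → <-irrefl e q)))) refl
... | no ne = trans (cong₂ _+_ (Σ-single n f i0 (≤∧≢⇒< (≤-pred p) ne) (λ i q → h i (m<n⇒m<1+n q)))
    (h n ≤-refl (λ e → ne (sym e)))) (+-identityʳ _)

Σ-trunc : ∀ m n (f : ℕ → ℕ) → m ≤ n → (∀ i → m ≤ i → i < n → f i ≡ 0) → Σ< n f ≡ Σ< m f
Σ-trunc m n f le h with m≤n⇒∃[o]m+o≡n le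
... | o , refl = trans (Σ-split m o f)
    (trans (cong (Σ< m f +_) (Σ-zero o (λ i q → h (m + i) (m≤m+n m i) (+-monoʳ-< m q)))) (+-identityʳ _))

Σ-reverse : ∀ n (f : ℕ → ℕ) → Σ< n f ≡ Σ< n (λ i → f (n ∸ suc i))
Σ-reverse zero f = refl
Σ-reverse (suc n) f = trans (cong (_+ f n) (Σ-reverse n f))
    (trans (+-comm _ (f n)) (sym (trans (Σ-head n (λ i → f (suc n ∸ suc i))) refl)))

Σ-support : ∀ m n (f : ℕ → ℕ) → (∀ i → f i ≢ 0 → i < m × i < n) → Σ< m f ≡ Σ< n f
Σ-support m n f h with ≤-total m n
... | inj₁ m≤n = sym (Σ-trunc m n f m≤n (λ i p _ → decidable-stable (f i ≟ 0) (λ q → <⇒≱ (proj₁ (h i q)) p)))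
... | inj₂ n≤m = Σ-trunc n m f n≤m (λ i p _ → decidable-stable (f i ≟ 0) (λ q → <⇒≱ (proj₂ (h i q)) p))

Σ-blocks : ∀ k α (F : ℕ → ℕ) → Σ< k (λ i → Σ< α (λ b → F (i * α + b))) ≡ Σ< (k * α) F
Σ-blocks zero α F = refl
Σ-blocks (suc k) α F = trans (cong (_+ Σ< α (λ b → F (k * α + b))) (Σ-blocks k α F))
    (trans (sym (Σ-split (k * α) α F)) (cong (λ x → Σ< x F) (+-comm (k * α) α)))

Σ-progressions : ∀ k α (G : ℕ → ℕ) → 1 ≤ α → α ≤ k → (∀ q → k < q → G q ≡ 0) →
  Σ< α (λ b → Σ< k (λ i → G (suc b + suc i * α))) ≡ Σ< (suc k) (λ q → if does (α <? q) then G q else 0)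
Σ-progressions k α G α1 αk Gz =
  trans (Σ-comm α k _)
  (trans (Σ-cong k (λ i _ → Σ-cong α (λ b _ → cong G (ar b i))))
  (trans (Σ-blocks k α (λ j → G (suc α + j)))
  (trans (Σ-support (k * α) (k ∸ α) (λ j → G (suc α + j)) nz)
  (sym (trans (cong (λ x → Σ< x (λ q → if does (α <? q) then G q else 0)) (sym (cong suc (m+[n∸m]≡n αk))))
         (trans (Σ-split (suc α) (k ∸ α) _)
           (trans (cong₂ _+_ (Σ-zero (suc α) (λ q p → if-no (α <? q) _ 0 (λ z → <⇒≱ z (≤-pred p))))
               (Σ-cong (k ∸ α) (λ j _ → if-yes (α <? suc α + j) _ 0 (s≤s (m≤m+n α j))))) refl)))))))
  where
  ar : ∀ b i → suc b + suc i * α ≡ suc α + (i * α + b)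
  ar b i = cong suc (lem b i α)
    where
    lem : ∀ b i α → b + (α + i * α) ≡ α + (i * α + b)
    lem = solve-∀
  nz : ∀ j → G (suc α + j) ≢ 0 → j < k * α × j < k ∸ α
  nz j ne = dec-elim (k <? suc α + j) (λ lt → ⊥-elim (ne (Gz _ lt))) (λ nlt → let le = ≮⇒≥ nlt in
      (<-≤-trans (j<k∸α le)
          (≤-trans (m∸n≤m k α) (≤-trans (≤-reflexive (sym (*-identityʳ k))) (*-monoʳ-≤ k α1)))) , j<k∸α le)
    where
    j<k∸α : suc α + j ≤ k → j < k ∸ α
    j<k∸α le = m+n≤o⇒m≤o∸n (suc j) (subst (_≤ k) (trans (+-comm (suc α) j) (+-suc j α)) le)

if-Σ : ∀ b n (g : ℕ → ℕ) → Σ< n (λ i → if b then g i else 0) ≡ (if b then Σ< n g else 0)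
if-Σ true n g = refl
if-Σ false n g = Σ-zero n (λ _ _ → refl)

isOdd : ℕ → Bool
isOdd zero = false
isOdd (suc zero) = true
isOdd (suc (suc n)) = isOdd n

⌊2*n/2⌋≡n : ∀ i → ⌊ 2 * i /2⌋ ≡ i
⌊2*n/2⌋≡n zero = refl
⌊2*n/2⌋≡n (suc i) rewrite +-suc i (i + 0) = cong suc (⌊2*n/2⌋≡n i)

⌊1+2*n/2⌋≡n : ∀ i → ⌊ suc (2 * i) /2⌋ ≡ i
⌊1+2*n/2⌋≡n zero = refl
⌊1+2*n/2⌋≡n (suc i) rewrite +-suc i (i + 0) = cong suc (⌊1+2*n/2⌋≡n i)

isOdd-2* : ∀ i → isOdd (2 * i) ≡ false
isOdd-2* zero = refl
isOdd-2* (suc i) rewrite +-suc i (i + 0) = isOdd-2* i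

isOdd-1+2* : ∀ i → isOdd (suc (2 * i)) ≡ true
isOdd-1+2* zero = refl
isOdd-1+2* (suc i) rewrite +-suc i (i + 0) = isOdd-1+2* i

parity-view : ∀ n → (n ≡ 2 * ⌊ n /2⌋ × isOdd n ≡ false) ⊎ (n ≡ suc (2 * ⌊ n /2⌋) × isOdd n ≡ true)
parity-view zero = inj₁ (refl , refl)
parity-view (suc zero) = inj₂ (refl , refl)
parity-view (suc (suc n)) with parity-view n
... | inj₁ (e , p) = inj₁ (trans (cong (suc ∘ suc) e) (cong suc (sym (+-suc ⌊ n /2⌋ (⌊ n /2⌋ + 0)))) , p)
... | inj₂ (e , p) = inj₂ (trans (cong (suc ∘ suc) e) (cong (suc ∘ suc) (sym (+-suc ⌊ n /2⌋ (⌊ n /2⌋ + 0)))) , p)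

2*suc : ∀ m → 2 * suc m ≡ suc (suc (2 * m))
2*suc m = cong suc (+-suc m (m + 0))

Σ-2* : ∀ m (f : ℕ → ℕ) → Σ< (2 * m) f ≡ Σ< m (λ i → f (2 * i)) + Σ< m (λ i → f (suc (2 * i)))
Σ-2* zero f = refl
Σ-2* (suc m) f = trans (cong (λ x → Σ< x f) (2*suc m))
    (trans (cong (λ x → x + f (2 * m) + f (suc (2 * m))) (Σ-2* m f))
    (ab-cd (Σ< m (λ i → f (2 * i))) (Σ< m (λ i → f (suc (2 * i)))) (f (2 * m)) (f (suc (2 * m)))))
  where
  ab-cd : ∀ a b c d → a + b + c + d ≡ a + c + (b + d)
  ab-cd = solve-∀

Σ-even+odd-2* : ∀ m (f : ℕ → ℕ) →
  Σ< (2 * m) f ≡ Σ< ⌊ suc (2 * m) /2⌋ (λ i → f (2 * i)) + Σ< ⌊ 2 * m /2⌋ (λ i → f (suc (2 * i)))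
Σ-even+odd-2* m f rewrite ⌊1+2*n/2⌋≡n m | ⌊2*n/2⌋≡n m = Σ-2* m f

Σ-even+odd-1+2* : ∀ m (f : ℕ → ℕ) →
  Σ< (suc (2 * m)) f ≡ Σ< ⌊ suc (suc (2 * m)) /2⌋ (λ i → f (2 * i)) + Σ< ⌊ suc (2 * m) /2⌋ (λ i → f (suc (2 * i)))
Σ-even+odd-1+2* m f rewrite ⌊2*n/2⌋≡n m | ⌊1+2*n/2⌋≡n m = trans (cong (_+ f (2 * m)) (Σ-2* m f))
    (acb (Σ< m (λ i → f (2 * i))) (Σ< m (λ i → f (suc (2 * i)))) (f (2 * m)))
  where
  acb : ∀ a b c → a + b + c ≡ a + c + b
  acb = solve-∀

Σ-even+odd : ∀ n (f : ℕ → ℕ) → Σ< n f ≡ Σ< ⌊ suc n /2⌋ (λ i → f (2 * i)) + Σ< ⌊ n /2⌋ (λ i → f (suc (2 * i)))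
Σ-even+odd n f with parity-view n
... | inj₁ (e , _) = subst
    (λ x → Σ< x f ≡ Σ< ⌊ suc x /2⌋ (λ i → f (2 * i)) + Σ< ⌊ x /2⌋ (λ i → f (suc (2 * i)))) (sym e)
    (Σ-even+odd-2* ⌊ n /2⌋ f)
... | inj₂ (e , _) = subst
    (λ x → Σ< x f ≡ Σ< ⌊ suc x /2⌋ (λ i → f (2 * i)) + Σ< ⌊ x /2⌋ (λ i → f (suc (2 * i)))) (sym e)
    (Σ-even+odd-1+2* ⌊ n /2⌋ f)

length-filter-∷ : ∀ {P : ℕ → Set} (P? : ∀ x → Dec (P x)) x xs → length (filter P? (x ∷ xs)) ≡ 𝟙
    (does (P? x)) + length (filter P? xs)
length-filter-∷ P? x xs with does (P? x)
... | true = refl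
... | false = refl

length-filter-applyUpTo : ∀ {P : ℕ → Set} (P? : ∀ x → Dec (P x)) n (g : ℕ → ℕ) → length
    (filter P? (applyUpTo g n)) ≡ Σ< n (λ i → 𝟙 (does (P? (g i))))
length-filter-applyUpTo P? zero g = refl
length-filter-applyUpTo P? (suc n) g = trans (length-filter-∷ P? (g 0) (applyUpTo (g ∘ suc) n))
    (trans (cong (𝟙 (does (P? (g 0))) +_) (length-filter-applyUpTo P? n (g ∘ suc)))
    (sym (Σ-head n (λ i → 𝟙 (does (P? (g i)))))))

sum-map-applyUpTo : ∀ n (f g : ℕ → ℕ) → sum (map f (applyUpTo g n)) ≡ Σ< n (λ i → f (g i))
sum-map-applyUpTo zero f g = refl
sum-map-applyUpTo (suc n) f g = trans (cong (f (g 0) +_) (sum-map-applyUpTo n f (g ∘ suc)))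
    (sym (Σ-head n (λ i → f (g i))))

length-filter-range : ∀ {P : ℕ → Set} (P? : ∀ x → Dec (P x)) a b → length (filter P? (range a b)) ≡
    Σ< (b ∸ a) (λ i → 𝟙 (does (P? (a + i))))
length-filter-range P? a b = trans (cong (λ l → length (filter P? l)) (map-upTo (a +_) (b ∸ a)))
    (length-filter-applyUpTo P? (b ∸ a) (a +_))

sum-map-range : ∀ (f : ℕ → ℕ) a b → sum (map f (range a b)) ≡ Σ< (b ∸ a) (λ i → f (a + i))
sum-map-range f a b = trans (cong (λ l → sum (map f l)) (map-upTo (a +_) (b ∸ a)))
    (sum-map-applyUpTo (b ∸ a) f (a +_))

-- Fibonacci partitions on a block

fib≥1 : ∀ n → 1 ≤ fib n
fib≥1 zero = s≤s z≤n
fib≥1 (suc zero) = s≤s z≤n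
fib≥1 (suc (suc n)) = ≤-trans (fib≥1 (suc n)) (m≤m+n _ _)

fib-≤-suc : ∀ n → fib n ≤ fib (suc n)
fib-≤-suc zero = ≤-refl
fib-≤-suc (suc n) = m≤m+n _ _

fib-mono : ∀ {i j} → i ≤ j → fib i ≤ fib j
fib-mono {i} {j} le with m≤n⇒∃[o]m+o≡n le
... | o , refl = go i o
  where
  go : ∀ i o → fib i ≤ fib (i + o)
  go i zero rewrite +-identityʳ i = ≤-refl
  go i (suc o) rewrite +-suc i o = ≤-trans (go i o) (fib-≤-suc (i + o))

n<fib[1+n] : ∀ n → n < fib (suc n)
n<fib[1+n] zero = s≤s z≤n
n<fib[1+n] (suc n) = subst (_≤ fib (suc (suc n))) (+-comm (suc n) 1) (+-mono-≤ (n<fib[1+n] n) (fib≥1 n))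

countSub-0 : ∀ i → countSub i 0 ≡ 1
countSub-0 zero = refl
countSub-0 (suc i) = trans
    (cong (countSub i 0 +_) (if-no (fib (suc i) ≤? 0) _ 0 (<⇒≱ (fib≥1 (suc i)))))
    (trans (+-identityʳ _) (countSub-0 i))

countSub-take : ∀ m n → fib (suc m) ≤ n → countSub (suc m) n ≡ countSub m n + countSub m (n ∸ fib (suc m))
countSub-take m n le = cong (countSub m n +_) (if-yes (fib (suc m) ≤? n) _ 0 le)

countSub-skip : ∀ m n → n < fib (suc m) → countSub (suc m) n ≡ countSub m n
countSub-skip m n lt = trans (cong (countSub m n +_) (if-no (fib (suc m) ≤? n) _ 0 (<⇒≱ lt))) (+-identityʳ _)

countSub-beyond : ∀ m n → fib (suc (suc m)) ≤ suc n → countSub m n ≡ 0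
countSub-beyond zero zero (s≤s ())
countSub-beyond zero (suc n) le = refl
countSub-beyond (suc m) n le with fib (suc m) ≤? n
... | yes p = trans (countSub-take m n p)
    (cong₂ _+_ (countSub-beyond m n (≤-trans (fib-≤-suc (suc (suc m))) le))
    (countSub-beyond m (n ∸ fib (suc m)) le'))
  where
  le' : fib (suc (suc m)) ≤ suc (n ∸ fib (suc m))
  le' = +-cancelʳ-≤ (fib (suc m)) _ _
      (subst (fib (suc (suc m)) + fib (suc m) ≤_)
      (sym (trans (cong (_+ fib (suc m)) (sym (+-∸-assoc 1 p))) (m∸n+n≡m (≤-trans p (n≤1+n n))))) le)
... | no ¬p = trans (countSub-skip m n (≰⇒> ¬p)) (countSub-beyond m n (≤-trans (fib-≤-suc (suc (suc m))) le))

countSub-stable : ∀ i j n → n < fib (suc i) → i ≤ j → countSub j n ≡ countSub i n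
countSub-stable i j n lt le with m≤n⇒∃[o]m+o≡n le
... | o , refl = go o
  where
  go : ∀ o → countSub (i + o) n ≡ countSub i n
  go zero rewrite +-identityʳ i = refl
  go (suc o) rewrite +-suc i o = trans (countSub-skip (i + o) n (<-≤-trans lt (fib-mono (s≤s (m≤m+n i o))))) (go o)

F≡countSub : ∀ i n → n < fib (suc i) → F n ≡ countSub i n
F≡countSub i n lt = trans (sym (countSub-stable n (n ⊔ i) n (n<fib[1+n] n) (m≤m⊔n n i)))
    (countSub-stable i (n ⊔ i) n lt (m≤n⊔m n i))

-- For fib r ≤ n < fib (suc r): the partitions of n that contain fib r, resp. avoid it.
Fwith : ℕ → ℕ → ℕ
Fwith r n = F (n ∸ fib r)

Fwithout : ℕ → ℕ → ℕ
Fwithout r n = countSub (r ∸ 1) n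

countShifted : ℕ → ℕ → ℕ
countShifted i m = countSub i (fib i + m)

countSub-shiftTop : ∀ i m → countSub (suc i) (fib (suc (suc i)) + m) ≡ countShifted i m
countSub-shiftTop i m = trans (countSub-take i _ (≤-trans (m≤m+n (fib (suc i)) (fib i)) (m≤m+n _ m)))
  (cong₂ _+_ (countSub-beyond i _ (≤-trans (m≤m+n _ m) (n≤1+n _))) (cong (countSub i) e))
  where
  e : fib (suc (suc i)) + m ∸ fib (suc i) ≡ fib i + m
  e = trans (cong (_∸ fib (suc i)) (+-assoc (fib (suc i)) (fib i) m)) (m+n∸m≡n (fib (suc i)) _)

countShifted-+2 : ∀ i m → countShifted (suc (suc i)) m ≡ countShifted i m + countSub (suc i) m
countShifted-+2 i m = trans (countSub-take (suc i) _ (m≤m+n _ m))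
    (cong₂ _+_ (countSub-shiftTop i m) (cong (countSub (suc i)) (m+n∸m≡n (fib (suc (suc i))) m)))

countShifted≡Fwithout : ∀ j' m → fib (suc j') ≤ m → countShifted (suc j') m ≡ Fwithout (suc j') m
countShifted≡Fwithout j' m le = trans (countSub-take j' _ (m≤m+n _ m))
  (cong₂ _+_ (countSub-beyond j' _ le1) (cong (countSub j') (m+n∸m≡n (fib (suc j')) m)))
  where
  le1 : fib (suc (suc j')) ≤ suc (fib (suc j') + m)
  le1 = ≤-trans (+-monoʳ-≤ (fib (suc j')) (≤-trans (fib-≤-suc j') le)) (n≤1+n _)

countShifted≡F : ∀ j m → fib j ≤ m → m < fib (suc j) → countShifted (suc j) m ≡ F m
countShifted≡F j m le lt = trans (countSub-take j _ (m≤m+n _ m))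
  (trans (cong₂ _+_ (countSub-beyond j _ le1) (cong (countSub j) (m+n∸m≡n (fib (suc j)) m)))
      (sym (F≡countSub j m lt)))
  where
  le1 : fib (suc (suc j)) ≤ suc (fib (suc j) + m)
  le1 = ≤-trans (+-monoʳ-≤ (fib (suc j)) le) (n≤1+n _)

countShifted-+2* : ∀ j t m → m < fib (suc j) → countShifted (j + 2 * t) m ≡ countShifted j m + t * F m
countShifted-+2* j zero m lt rewrite +-identityʳ j = sym (+-identityʳ _)
countShifted-+2* j (suc t) m lt = begin
    countShifted (j + 2 * suc t) m
  ≡⟨ cong (λ x → countShifted x m) e ⟩
    countShifted (suc (suc (j + 2 * t))) m
  ≡⟨ countShifted-+2 (j + 2 * t) m ⟩
    countShifted (j + 2 * t) m + countSub (suc (j + 2 * t)) m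
  ≡⟨ cong₂ _+_ (countShifted-+2* j t m lt) (sym (F≡countSub (suc (j + 2 * t)) m lt′)) ⟩
    countShifted j m + t * F m + F m
  ≡⟨ +-assoc (countShifted j m) (t * F m) (F m) ⟩
    countShifted j m + (t * F m + F m)
  ≡⟨ cong (countShifted j m +_) (+-comm (t * F m) (F m)) ⟩
    countShifted j m + suc t * F m ∎
  where
  open ≡-Reasoning
  e : j + 2 * suc t ≡ suc (suc (j + 2 * t))
  e = trans (cong (j +_) (2*suc t)) (trans (+-suc j _) (cong suc (+-suc j _)))
  lt′ : m < fib (suc (suc (j + 2 * t)))
  lt′ = <-≤-trans lt (fib-mono (s≤s (≤-trans (m≤m+n j (2 * t)) (n≤1+n _))))

F≡Fwith+Fwithout : ∀ j' m → fib (suc j') ≤ m → m < fib (suc (suc j')) →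
  F m ≡ Fwith (suc j') m + Fwithout (suc j') m
F≡Fwith+Fwithout j' m le lt = trans (F≡countSub (suc j') m lt)
    (trans (countSub-take j' m le)
    (trans (+-comm (countSub j' m) (countSub j' (m ∸ fib (suc j'))))
    (cong (_+ countSub j' m) (sym (F≡countSub j' (m ∸ fib (suc j')) lt2)))))
  where
  lt2 : m ∸ fib (suc j') < fib (suc j')
  lt2 = +-cancelʳ-< _ _ (fib (suc j'))
      (subst (_< fib (suc j') + fib (suc j')) (sym (m∸n+n≡m le))
      (<-≤-trans lt (+-monoʳ-≤ (fib (suc j')) (fib-≤-suc j'))))

Fwith-shift : ∀ r m → Fwith r (fib r + m) ≡ F m
Fwith-shift r m = cong F (m+n∸m≡n (fib r) m)

weight : ℕ → ℕ → ℕ → ℕ → ℕ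
weight r u α n = u * Fwith r n + α * Fwithout r n

F≡weight-1-1 : ∀ j m → fib (suc j) ≤ m → m < fib (suc (suc j)) → F m ≡ weight (suc j) 1 1 m
F≡weight-1-1 j m le lt = trans (F≡Fwith+Fwithout j m le lt)
    (sym (cong₂ _+_ (*-identityˡ (Fwith (suc j) m)) (*-identityˡ (Fwithout (suc j) m))))

weight-shift-even : ∀ u α j' t m → fib (suc j') ≤ m → m < fib (suc (suc j')) →
  weight (suc (suc (suc j' + 2 * t))) u α (fib (suc (suc (suc j' + 2 * t))) + m)
  ≡ weight (suc j') (u + t * α) (u + suc t * α) m
weight-shift-even u α j' t m le lt
  rewrite Fwith-shift (suc (suc (suc j' + 2 * t))) m
        | countSub-shiftTop (suc j' + 2 * t) m
        | countShifted-+2* (suc j') t m lt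
        | countShifted≡Fwithout j' m le
        | F≡Fwith+Fwithout j' m le lt
  = alg u α t (Fwith (suc j') m) (Fwithout (suc j') m)
  where
  alg : ∀ u α t x y → u * (x + y) + α * (y + t * (x + y)) ≡ (u + t * α) * x + (u + suc t * α) * y
  alg = solve-∀

weight-shift-odd : ∀ u α j' t m → fib (suc j') ≤ m → m < fib (suc (suc j')) →
  weight (suc (suc (suc (suc j') + 2 * t))) u α (fib (suc (suc (suc (suc j') + 2 * t))) + m)
  ≡ (u + suc t * α) * F m
weight-shift-odd u α j' t m le lt
  rewrite Fwith-shift (suc (suc (suc (suc j') + 2 * t))) m
        | countSub-shiftTop (suc (suc j') + 2 * t) m
        | countShifted-+2* (suc (suc j')) t m (<-≤-trans lt (fib-≤-suc (suc (suc j'))))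
        | countShifted≡F (suc j') m le lt
        | F≡Fwith+Fwithout j' m le lt
  = alg u α t (Fwith (suc j') m) (Fwithout (suc j') m)
  where
  alg : ∀ u α t x y → u * (x + y) + α * (x + y + t * (x + y)) ≡ (u + suc t * α) * (x + y)
  alg = solve-∀

Fwith-start : ∀ r → Fwith r (fib r) ≡ 1
Fwith-start r = cong F (n∸n≡0 (fib r))

countShifted-0 : ∀ i → countShifted i 0 ≡ ⌊ suc i /2⌋
countShifted-0 zero = refl
countShifted-0 (suc zero) = refl
countShifted-0 (suc (suc i)) = trans (countShifted-+2 i 0)
    (trans (cong₂ _+_ (countShifted-0 i) (countSub-0 (suc i))) (+-comm _ 1))

Fwithout-start : ∀ r → 1 ≤ r → Fwithout r (fib r) ≡ ⌊ r ∸ 1 /2⌋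
Fwithout-start (suc zero) _ = refl
Fwithout-start (suc (suc r')) _ = trans (cong (countSub (suc r')) (sym (+-identityʳ _)))
    (trans (countSub-shiftTop r' 0) (countShifted-0 r'))

-- The recursion K

-- K r u α k is a closed recursion for blockCount r u α k (see blockCount≡K). Its summands come
-- from n = fib r, from the sub-blocks on which the weight becomes that of the child pair
-- (u + i α, u + (i + 1) α), and from those on which it becomes (u + (i + 1) α) * F.
K-base : ℕ → ℕ → ℕ → ℕ → ℕ
K-base zero u α k = 0
K-base (suc r) u α k = 𝟙 (does (u + α * ⌊ r /2⌋ ≟ k))

-- k / q for q ≥ 1, in the form used by Ψ-fuel, so that no NonZero instance is needed.
quotient : ℕ → ℕ → ℕ
quotient k q = k / suc (q ∸ 1)

K-cut : (ℕ → ℕ → ℕ → ℕ → ℕ) → ℕ → ℕ → ℕ → ℕ → ℕ → ℕ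
K-cut kf r u α k b = if does ((u + b * α) ∣? k) then kf (r ∸ suc (2 * b)) 1 1 (quotient k (u + b * α)) else 0

Kᶠ : ℕ → ℕ → ℕ → ℕ → ℕ → ℕ
Kᶠ zero r u α k = 0
Kᶠ (suc f) r u α k = K-base r u α k
  + Σ< ⌊ r /2⌋ (λ i → Kᶠ f (r ∸ 2 * suc i) (u + i * α) (u + suc i * α) k)
  + Σ< ⌊ r ∸ 2 /2⌋ (λ i → K-cut (Kᶠ f) r u α k (suc i))

K : ℕ → ℕ → ℕ → ℕ → ℕ
K r = Kᶠ (suc r) r

<⌊n/2⌋⇒2*suc≤ : ∀ r i → i < ⌊ r /2⌋ → 2 * suc i ≤ r
<⌊n/2⌋⇒2*suc≤ (suc (suc r)) zero _ = s≤s (s≤s z≤n)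
<⌊n/2⌋⇒2*suc≤ (suc (suc r)) (suc i) (s≤s lt) = subst (_≤ suc (suc r)) (sym (2*suc (suc i)))
    (s≤s (s≤s (<⌊n/2⌋⇒2*suc≤ r i lt)))

2*suc≤⇒<⌊n/2⌋ : ∀ r i → 2 * suc i ≤ r → i < ⌊ r /2⌋
2*suc≤⇒<⌊n/2⌋ (suc (suc r)) zero _ = s≤s z≤n
2*suc≤⇒<⌊n/2⌋ (suc (suc r)) (suc i) le = s≤s
    (2*suc≤⇒<⌊n/2⌋ r i (≤-pred (≤-pred (subst (_≤ suc (suc r)) (2*suc (suc i)) le))))
2*suc≤⇒<⌊n/2⌋ zero i ()
2*suc≤⇒<⌊n/2⌋ (suc zero) zero (s≤s ())
2*suc≤⇒<⌊n/2⌋ (suc zero) (suc i) (s≤s ())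

∸-< : ∀ r x → 0 < x → x ≤ r → r ∸ x < r
∸-< r x p q = ∸-monoʳ-< {r} {x} {0} p q

<n∸2⇒+2≤n : ∀ a r → suc a ≤ r ∸ 2 → suc a + 2 ≤ r
<n∸2⇒+2≤n a (suc (suc r)) le = m≤o∸n⇒m+n≤o (suc a) (s≤s (s≤s z≤n)) le
<n∸2⇒+2≤n a zero ()
<n∸2⇒+2≤n a (suc zero) ()

<⌊n∸2/2⌋⇒1+2*suc≤ : ∀ r i → i < ⌊ r ∸ 2 /2⌋ → suc (2 * suc i) ≤ r
<⌊n∸2/2⌋⇒1+2*suc≤ r i p = ≤-trans (≤-trans (n≤1+n _) (≤-reflexive (+-comm 2 (2 * suc i))))
    (<n∸2⇒+2≤n _ r (<⌊n/2⌋⇒2*suc≤ (r ∸ 2) i p))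

Kᶠ-fuel-irrelevant : ∀ f f' r u α k → r < f → r < f' → Kᶠ f r u α k ≡ Kᶠ f' r u α k
Kᶠ-fuel-irrelevant (suc f) (suc f') r u α k (s≤s lt) (s≤s lt') =
  cong₂ _+_ (cong (K-base r u α k +_)
      (Σ-cong ⌊ r /2⌋ (λ i p → Kᶠ-fuel-irrelevant f f' _ _ _ k (ev i p lt) (ev i p lt'))))
    (Σ-cong ⌊ r ∸ 2 /2⌋ (λ i p → od i p))
  where
  ev : ∀ {g} i → i < ⌊ r /2⌋ → r ≤ g → r ∸ 2 * suc i < g
  ev {g} i p le = <-≤-trans (∸-< r (2 * suc i) (s≤s z≤n) (<⌊n/2⌋⇒2*suc≤ r i p)) le
  od : ∀ i → i < ⌊ r ∸ 2 /2⌋ → K-cut (Kᶠ f) r u α k (suc i) ≡ K-cut (Kᶠ f') r u α k (suc i)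
  od i p with (u + suc i * α) ∣? k
  ... | yes _ = Kᶠ-fuel-irrelevant f f' _ 1 1 _
      (<-≤-trans (∸-< r _ (s≤s z≤n) (<⌊n∸2/2⌋⇒1+2*suc≤ r i p)) lt)
      (<-≤-trans (∸-< r _ (s≤s z≤n) (<⌊n∸2/2⌋⇒1+2*suc≤ r i p)) lt')
  ... | no _ = refl

K-unfold : ∀ r u α k → K r u α k ≡ K-base r u α k
  + Σ< ⌊ r /2⌋ (λ i → K (r ∸ 2 * suc i) (u + i * α) (u + suc i * α) k)
  + Σ< ⌊ r ∸ 2 /2⌋ (λ i → K-cut K r u α k (suc i))
K-unfold r u α k = cong₂ _+_
    (cong (K-base r u α k +_) (Σ-cong ⌊ r /2⌋ (λ i p → Kᶠ-fuel-irrelevant r _ _ _ _ k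
      (∸-< r (2 * suc i) (s≤s z≤n) (<⌊n/2⌋⇒2*suc≤ r i p)) ≤-refl)))
    (Σ-cong ⌊ r ∸ 2 /2⌋ od)
  where
  od : ∀ i → i < ⌊ r ∸ 2 /2⌋ → K-cut (Kᶠ r) r u α k (suc i) ≡ K-cut K r u α k (suc i)
  od i p with (u + suc i * α) ∣? k
  ... | yes _ = Kᶠ-fuel-irrelevant r _ _ 1 1 _ (∸-< r _ (s≤s z≤n) (<⌊n∸2/2⌋⇒1+2*suc≤ r i p)) ≤-refl
  ... | no _ = refl

blockCount : ℕ → ℕ → ℕ → ℕ → ℕ
blockCount r u α k = Σ< (fib (r ∸ 1)) (λ i → 𝟙 (does (weight r u α (fib r + i) ≟ k)))

subBlockCount : ℕ → ℕ → ℕ → ℕ → ℕ → ℕ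
subBlockCount r j u α k = Σ< (fib j) (λ i → 𝟙 (does (weight r u α (fib r + (fib (suc j) + i)) ≟ k)))

BlockCount≡K : ℕ → Set
BlockCount≡K r = ∀ u α k → 1 ≤ u → blockCount r u α k ≡ K r u α k

Σ-fibBlocks : ∀ J (f : ℕ → ℕ) → Σ< (fib (suc J)) f ≡ f 0 + Σ< J (λ j → Σ< (fib j) (λ i → f (fib (suc j) + i)))
Σ-fibBlocks zero f = +-comm 0 (f 0)
Σ-fibBlocks (suc J) f = trans (Σ-split (fib (suc J)) (fib J) f)
    (trans (cong (_+ Σ< (fib J) (λ i → f (fib (suc J) + i))) (Σ-fibBlocks J f)) (+-assoc (f 0) _ _))

𝟙-*≟ : ∀ q w k → 1 ≤ q → 𝟙 (does (q * w ≟ k)) ≡ (if does (q ∣? k) then 𝟙 (does (w ≟ quotient k q)) else 0)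
𝟙-*≟ (suc q') w k _ with suc q' ∣? k
... | yes d@(divides c e) = trans (𝟙-cong-⇔ (suc q' * w ≟ k) (w ≟ k / suc q')
        (λ e' → trans (*-cancelʳ-≡ w c (suc q') (trans (*-comm w (suc q')) (trans e' e)))
            (sym (trans (cong (_/ suc q') e) (m*n/n≡m c (suc q')))))
        (λ e' → trans (*-comm (suc q') w)
            (trans (cong (_* suc q') (trans e' (trans (cong (_/ suc q') e) (m*n/n≡m c (suc q'))))) (sym e))))
        (sym (if-yes (suc q' ∣? k) _ 0 d))
... | no ¬d = trans (𝟙-no (suc q' * w ≟ k)
    (λ e → ¬d (divides w (trans (sym e) (*-comm (suc q') w))))) (sym (if-no (suc q' ∣? k) _ 0 ¬d))

inBlock : ∀ j i → i < fib j → fib (suc j) ≤ fib (suc j) + i × fib (suc j) + i < fib (suc (suc j))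
inBlock j i lt = m≤m+n _ i , +-monoʳ-< (fib (suc j)) lt

blockCount-even : ∀ j t u α k → 1 ≤ u → BlockCount≡K (suc j) →
  subBlockCount (suc (suc (suc j + 2 * t))) j u α k
  ≡ K (suc j) (u + t * α) (u + suc t * α) k
blockCount-even j t u α k u≥1 IH = trans
    (Σ-cong (fib j) (λ i p → cong (λ x → 𝟙 (does (x ≟ k)))
    (weight-shift-even u α j t (fib (suc j) + i) (proj₁ (inBlock j i p)) (proj₂ (inBlock j i p)))))
    (IH _ _ k (≤-trans u≥1 (m≤m+n u _)))

blockCount-odd : ∀ j t u α k → 1 ≤ u → BlockCount≡K (suc j) →
  subBlockCount (suc (suc (suc (suc j) + 2 * t))) j u α k
  ≡ (if does ((u + suc t * α) ∣? k) then K (suc j) 1 1 (quotient k (u + suc t * α)) else 0)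
blockCount-odd j t u α k u≥1 IH = begin
    subBlockCount (suc (suc (suc (suc j) + 2 * t))) j u α k
  ≡⟨ Σ-cong (fib j) term ⟩
    Σ< (fib j) (λ i → if does (q ∣? k) then 𝟙 (does (weight (suc j) 1 1 (fib (suc j) + i) ≟ quotient k q)) else 0)
  ≡⟨ if-Σ (does (q ∣? k)) (fib j) _ ⟩
    (if does (q ∣? k) then blockCount (suc j) 1 1 (quotient k q) else 0)
  ≡⟨ if-cong (q ∣? k) (λ _ → IH 1 1 _ ≤-refl) ⟩
    (if does (q ∣? k) then K (suc j) 1 1 (quotient k q) else 0) ∎
  where
  open ≡-Reasoning
  R = suc (suc (suc (suc j) + 2 * t))
  q = u + suc t * α
  term : ∀ i → i < fib j → 𝟙 (does (weight R u α (fib R + (fib (suc j) + i)) ≟ k))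
                         ≡ (if does (q ∣? k) then 𝟙
                             (does (weight (suc j) 1 1 (fib (suc j) + i) ≟ quotient k q)) else 0)
  term i p = begin
      𝟙 (does (weight R u α (fib R + (fib (suc j) + i)) ≟ k))
    ≡⟨ cong (λ x → 𝟙 (does (x ≟ k))) (weight-shift-odd u α j t _ (proj₁ (inBlock j i p)) (proj₂ (inBlock j i p))) ⟩
      𝟙 (does (q * F (fib (suc j) + i) ≟ k))
    ≡⟨ 𝟙-*≟ q _ k (≤-trans u≥1 (m≤m+n u _)) ⟩
      (if does (q ∣? k) then 𝟙 (does (F (fib (suc j) + i) ≟ quotient k q)) else 0)
    ≡⟨ cong (λ x → if does (q ∣? k) then 𝟙 (does (x ≟ quotient k q)) else 0)
        (F≡weight-1-1 j _ (proj₁ (inBlock j i p)) (proj₂ (inBlock j i p))) ⟩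
      (if does (q ∣? k) then 𝟙 (does (weight (suc j) 1 1 (fib (suc j) + i) ≟ quotient k q)) else 0) ∎

-- The summand of K contributed by the sub-block of rank j with r = j + e + 3.
K-term : ℕ → ℕ → ℕ → ℕ → ℕ → ℕ
K-term r u α k e =
  if isOdd e then K-cut K r u α k (suc ⌊ e /2⌋)
  else K (r ∸ 2 * suc ⌊ e /2⌋) (u + ⌊ e /2⌋ * α) (u + suc ⌊ e /2⌋ * α) k

[3+j+2t]∸2[1+t]≡1+j : ∀ j t → suc (suc (suc j + 2 * t)) ∸ 2 * suc t ≡ suc j
[3+j+2t]∸2[1+t]≡1+j j t = trans (cong (suc (suc (suc j + 2 * t)) ∸_) (2*suc t)) (m+n∸n≡m (suc j) (2 * t))

[4+j+2t]∸[1+2[1+t]]≡1+j : ∀ j t → suc (suc (suc (suc j) + 2 * t)) ∸ suc (2 * suc t) ≡ suc j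
[4+j+2t]∸[1+2[1+t]]≡1+j j t = trans
    (cong (λ x → suc (suc (suc (suc j) + 2 * t)) ∸ suc x) (2*suc t)) (m+n∸n≡m (suc j) (2 * t))

K-term-even : ∀ j t u α k → 1 ≤ u → BlockCount≡K (suc j) →
  subBlockCount (suc (suc (suc j + 2 * t))) j u α k
  ≡ K-term (suc (suc (suc j + 2 * t))) u α k (2 * t)
K-term-even j t u α k u≥1 IH
  rewrite isOdd-2* t | ⌊2*n/2⌋≡n t | [3+j+2t]∸2[1+t]≡1+j j t
  = blockCount-even j t u α k u≥1 IH

K-term-odd : ∀ j t u α k → 1 ≤ u → BlockCount≡K (suc j) →
  subBlockCount (suc (suc (suc j + suc (2 * t)))) j u α k
  ≡ K-term (suc (suc (suc j + suc (2 * t)))) u α k (suc (2 * t))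
K-term-odd j t u α k u≥1 IH
  rewrite isOdd-1+2* t | ⌊1+2*n/2⌋≡n t | +-suc j (2 * t) | [4+j+2t]∸[1+2[1+t]]≡1+j j t
  = blockCount-odd j t u α k u≥1 IH

blockCount≡K-term : ∀ r'' j u α k → j < r'' → 1 ≤ u → BlockCount≡K (suc j) →
  subBlockCount (suc (suc r'')) j u α k ≡ K-term (suc (suc r'')) u α k (r'' ∸ suc j)
blockCount≡K-term r'' j u α k lt u≥1 IH with m≤n⇒∃[o]m+o≡n lt
... | e , refl rewrite m+n∸m≡n (suc j) e with parity-view e
... | inj₁ (ee , _) = subst
    (λ x → subBlockCount (suc (suc (suc j + x))) j u α k ≡ K-term (suc (suc (suc j + x))) u α k x)
    (sym ee) (K-term-even j ⌊ e /2⌋ u α k u≥1 IH)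
... | inj₂ (ee , _) = subst
    (λ x → subBlockCount (suc (suc (suc j + x))) j u α k ≡ K-term (suc (suc (suc j + x))) u α k x)
    (sym ee) (K-term-odd j ⌊ e /2⌋ u α k u≥1 IH)

⌈n/2⌉≤1+⌊n/2⌋ : ∀ n → ⌊ suc n /2⌋ ≤ suc ⌊ n /2⌋
⌈n/2⌉≤1+⌊n/2⌋ zero = z≤n
⌈n/2⌉≤1+⌊n/2⌋ (suc zero) = s≤s z≤n
⌈n/2⌉≤1+⌊n/2⌋ (suc (suc n)) = s≤s (⌈n/2⌉≤1+⌊n/2⌋ n)

n≤2*⌈n/2⌉ : ∀ n → n ≤ 2 * ⌊ suc n /2⌋
n≤2*⌈n/2⌉ zero = z≤n
n≤2*⌈n/2⌉ (suc zero) = s≤s z≤n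
n≤2*⌈n/2⌉ (suc (suc n)) = subst (suc (suc n) ≤_) (sym (2*suc ⌊ suc n /2⌋)) (s≤s (s≤s (n≤2*⌈n/2⌉ n)))

blockCount≡K : ∀ f r → r ≤ f → 1 ≤ r → BlockCount≡K r
blockCount≡K f (suc zero) _ _ u α k _ = trans
    (cong (λ x → 𝟙 (does (x ≟ k))) (cong₂ _+_ (*-identityʳ u) refl)) (sym (trans (+-identityʳ _) (+-identityʳ _)))
blockCount≡K (suc f) (suc (suc r'')) (s≤s le) _ u α k u≥1 = begin
    blockCount r u α k
  ≡⟨ Σ-fibBlocks r'' g ⟩
    g 0 + Σ< r'' (λ j → subBlockCount r j u α k)
  ≡⟨ cong₂ _+_ g0 (Σ-cong r'' (λ j p → blockCount≡K-term r'' j u α k p u≥1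
       (blockCount≡K f (suc j) (≤-trans p (≤-trans (n≤1+n r'') le)) (s≤s z≤n)))) ⟩
    K-base r u α k + Σ< r'' (λ j → K-term r u α k (r'' ∸ suc j))
  ≡⟨ cong (K-base r u α k +_) (sym (Σ-reverse r'' (K-term r u α k))) ⟩
    K-base r u α k + Σ< r'' (K-term r u α k)
  ≡⟨ cong (K-base r u α k +_) (trans (Σ-even+odd r'' (K-term r u α k)) (cong₂ _+_ evenPart oddPart)) ⟩
    K-base r u α k + (Σ< ⌊ r /2⌋ (λ i → K (r ∸ 2 * suc i) (u + i * α) (u + suc i * α) k)
                      + Σ< ⌊ r ∸ 2 /2⌋ (λ i → K-cut K r u α k (suc i)))
  ≡⟨ sym (+-assoc (K-base r u α k) _ _) ⟩
    K-base r u α k + Σ< ⌊ r /2⌋ (λ i → K (r ∸ 2 * suc i) (u + i * α) (u + suc i * α) k)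
                   + Σ< ⌊ r ∸ 2 /2⌋ (λ i → K-cut K r u α k (suc i))
  ≡⟨ K-unfold r u α k ⟨
    K r u α k ∎
  where
  open ≡-Reasoning
  r = suc (suc r'')
  g : ℕ → ℕ
  g i = 𝟙 (does (weight r u α (fib r + i) ≟ k))
  g0 : g 0 ≡ K-base r u α k
  g0 = cong (λ x → 𝟙 (does (x ≟ k)))
      (trans (cong (weight r u α) (+-identityʳ (fib r)))
      (cong₂ _+_ (trans (cong (u *_) (Fwith-start r)) (*-identityʳ u)) (cong (α *_) (Fwithout-start r (s≤s z≤n)))))
  evenPart : Σ< ⌊ suc r'' /2⌋ (λ i → K-term r u α k (2 * i)) ≡ Σ< ⌊ r /2⌋
      (λ i → K (r ∸ 2 * suc i) (u + i * α) (u + suc i * α) k)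
  evenPart = trans (Σ-cong ⌊ suc r'' /2⌋ (λ i _ → ev i))
      (sym (Σ-trunc ⌊ suc r'' /2⌋ ⌊ r /2⌋ _ (⌈n/2⌉≤1+⌊n/2⌋ r'') (λ i p _ → zr i p)))
    where
    ev : ∀ i → K-term r u α k (2 * i) ≡ K (r ∸ 2 * suc i) (u + i * α) (u + suc i * α) k
    ev i rewrite isOdd-2* i | ⌊2*n/2⌋≡n i = refl
    zr : ∀ i → ⌊ suc r'' /2⌋ ≤ i → K (r ∸ 2 * suc i) (u + i * α) (u + suc i * α) k ≡ 0
    zr i p = cong (λ x → K x (u + i * α) (u + suc i * α) k)
        (m≤n⇒m∸n≡0 (subst (r ≤_) (sym (2*suc i)) (s≤s (s≤s (≤-trans (n≤2*⌈n/2⌉ r'') (*-monoʳ-≤ 2 p))))))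
  oddPart : Σ< ⌊ r'' /2⌋ (λ i → K-term r u α k (suc (2 * i))) ≡ Σ< ⌊ r ∸ 2 /2⌋ (λ i → K-cut K r u α k (suc i))
  oddPart = Σ-cong ⌊ r'' /2⌋ (λ i _ → od i)
    where
    od : ∀ i → K-term r u α k (suc (2 * i)) ≡ K-cut K r u α k (suc i)
    od i rewrite isOdd-1+2* i | ⌊1+2*n/2⌋≡n i = refl

L≡K : ∀ r → 1 ≤ r → ∀ k → L r k ≡ K r 1 1 k
L≡K (suc r) _ k = begin
    L (suc r) k
  ≡⟨ length-filter-range (λ n → F n ≟ k) (fib (suc r)) (fib (suc (suc r))) ⟩
    Σ< (fib (suc (suc r)) ∸ fib (suc r)) (λ i → 𝟙 (does (F (fib (suc r) + i) ≟ k)))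
  ≡⟨ cong (λ x → Σ< x (λ i → 𝟙 (does (F (fib (suc r) + i) ≟ k)))) (m+n∸m≡n (fib (suc r)) (fib r)) ⟩
    Σ< (fib r) (λ i → 𝟙 (does (F (fib (suc r) + i) ≟ k)))
  ≡⟨ Σ-cong (fib r) (λ i p → cong (λ x → 𝟙 (does (x ≟ k)))
      (F≡weight-1-1 r _ (m≤m+n _ i) (+-monoʳ-< (fib (suc r)) p))) ⟩
    blockCount (suc r) 1 1 k
  ≡⟨ blockCount≡K (suc r) (suc r) ≤-refl (s≤s z≤n) 1 1 k ≤-refl ⟩
    K (suc r) 1 1 k ∎
  where open ≡-Reasoning

pointMass : ℕ → ℕ → ℕ → ℕ
pointMass zero u k = 0
pointMass (suc r) u k = 𝟙 (does (u ≟ k))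

pointMass-≢ : ∀ r u k → u ≢ k → pointMass r u k ≡ 0
pointMass-≢ zero u k _ = refl
pointMass-≢ (suc r) u k ne = 𝟙-no (u ≟ k) ne

𝟙-> : ∀ x k → k < x → 𝟙 (does (x ≟ k)) ≡ 0
𝟙-> x k lt = 𝟙-no (x ≟ k) (λ e → <-irrefl (sym e) lt)

>⇒∤ : ∀ q k → 1 ≤ k → k < q → ¬ (q ∣ k)
>⇒∤ q (suc k) _ lt d = <⇒≱ lt (∣⇒≤ d)

K-cut-< : ∀ r u α k b → 1 ≤ k → k < u + b * α → K-cut K r u α k b ≡ 0
K-cut-< r u α k b k≥1 lt = if-no ((u + b * α) ∣? k) _ 0 (>⇒∤ _ k k≥1 lt)

u+α≤childSnd : ∀ u α i → u + α ≤ u + suc i * α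
u+α≤childSnd u α i = +-monoʳ-≤ u (m≤m+n α (i * α))

α*suc≥ : ∀ α h → α ≤ α * suc h
α*suc≥ α h = subst (_≤ α * suc h) (*-identityʳ α) (*-monoʳ-≤ α (s≤s z≤n))

K-small : ∀ f r → r ≤ f → ∀ u α k → 1 ≤ k → 1 ≤ α → k < u + α → K r u α k ≡ pointMass r u k
K-small f zero le u α k k≥1 α≥1 lt = refl
K-small f (suc zero) le u α k k≥1 α≥1 lt = trans (K-unfold 1 u α k)
    (trans (+-identityʳ _)
    (trans (+-identityʳ _) (cong (λ x → 𝟙 (does (x ≟ k))) (trans (cong (u +_) (*-zeroʳ α)) (+-identityʳ u)))))
K-small f (suc (suc zero)) le u α k k≥1 α≥1 lt = trans (K-unfold 2 u α k)
    (trans (+-identityʳ _)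
    (trans (+-identityʳ _)
    (trans (cong (λ x → 𝟙 (does (u + x ≟ k))) (*-zeroʳ α)) (cong (λ x → 𝟙 (does (x ≟ k))) (+-identityʳ u)))))
K-small (suc f) (suc (suc (suc r'))) (s≤s le) u α k k≥1 α≥1 lt =
  trans (K-unfold r u α k)
  (trans (cong₂ _+_ (cong₂ _+_ b0
      (trans (Σ-head ⌊ suc r' /2⌋ T) (cong₂ _+_ T0 (Σ-zero ⌊ suc r' /2⌋ (λ i _ → Ts i)))))
                    (Σ-zero ⌊ suc r' /2⌋
                        (λ i _ → K-cut-< r u α k (suc i) k≥1 (<-≤-trans lt (u+α≤childSnd u α i)))))
   (trans (+-identityʳ _) (+-identityʳ _)))
  where
  r = suc (suc (suc r'))
  T : ℕ → ℕ
  T i = K (r ∸ 2 * suc i) (u + i * α) (u + suc i * α) k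
  b0 : K-base r u α k ≡ 0
  b0 = 𝟙-> _ k (<-≤-trans lt (+-monoʳ-≤ u (α*suc≥ α ⌊ r' /2⌋)))
  T0 : T 0 ≡ 𝟙 (does (u ≟ k))
  T0 = trans (K-small f (suc r') (≤-trans (n≤1+n _) le) (u + 0 * α) (u + 1 * α) k k≥1
      (≤-trans α≥1 (≤-trans (≤-reflexive (sym (*-identityˡ α))) (m≤n+m _ u)))
      (<-≤-trans lt (+-mono-≤ (≤-reflexive (sym (+-identityʳ u)))
      (≤-trans (≤-reflexive (sym (*-identityˡ α))) (m≤n+m _ u)))))
         (cong (λ x → 𝟙 (does (x ≟ k))) (+-identityʳ u))
  Ts : ∀ i → T (suc i) ≡ 0
  Ts i = trans (K-small f (r ∸ 2 * suc (suc i))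
      (≤-trans (∸-monoʳ-≤ r (s≤s (z≤n {2 * suc (suc i) ∸ 1}))) le) _ _ k k≥1 α'≥1 lt')
           (pointMass-≢ (r ∸ 2 * suc (suc i)) _ k (λ e → <-irrefl (sym e) (<-≤-trans lt (u+α≤childSnd u α i))))
    where
    α'≥1 : 1 ≤ u + suc (suc i) * α
    α'≥1 = ≤-trans α≥1 (≤-trans (m≤n+m _ u) (+-monoʳ-≤ u (m≤m+n α _)))
    lt' : k < u + suc i * α + (u + suc (suc i) * α)
    lt' = <-≤-trans lt (≤-trans (u+α≤childSnd u α i) (m≤m+n _ _))

-- The tree of coprime pairs

-- The children of (u , α) are (u + i α , u + (i + 1) α). Every coprime pair u < α has exactly
-- one parent, found by dividing u - 1 by α - u.
parentSnd : ℕ → ℕ → ℕ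
parentSnd u' α' = α' ∸ u'

childIndex : ℕ → ℕ → ℕ
childIndex u' α' = (u' ∸ 1) / suc (parentSnd u' α' ∸ 1)

parentFst : ℕ → ℕ → ℕ
parentFst u' α' = u' ∸ childIndex u' α' * parentSnd u' α'

childFst : ℕ → ℕ → ℕ → ℕ
childFst i u α = u + i * α

childSnd : ℕ → ℕ → ℕ → ℕ
childSnd i u α = u + suc i * α

childSnd-lower : ∀ u α i → 1 ≤ u → 1 ≤ α → suc i + α ≤ u + suc i * α
childSnd-lower (suc u₀) (suc a₀) i _ _ = subst (suc i + suc a₀ ≤_) (sym (eq u₀ a₀ i)) (m≤m+n _ _)
  where
  eq : ∀ u₀ a₀ i → suc u₀ + suc i * suc a₀ ≡ suc i + suc a₀ + (u₀ + i * a₀)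
  eq = solve-∀

parentSnd-child : ∀ i u α → parentSnd (childFst i u α) (childSnd i u α) ≡ α
parentSnd-child i u α = trans (cong (_∸ (u + i * α)) (lem u α (i * α))) (m+n∸m≡n (u + i * α) α)
  where
  lem : ∀ u α x → u + (α + x) ≡ u + x + α
  lem = solve-∀

childIndex-child : ∀ i u α₀ → 1 ≤ u → u ≤ suc α₀ → childIndex (childFst i u (suc α₀)) (childSnd i u (suc α₀)) ≡ i
childIndex-child i (suc u₀) α₀ _ u≤ = trans
    (cong (λ x → (suc u₀ + i * suc α₀ ∸ 1) / suc (x ∸ 1)) (parentSnd-child i (suc u₀) (suc α₀)))
  (trans (+-distrib-/ u₀ (i * suc α₀)
      (subst (_< suc α₀) (sym (trans (cong₂ _+_ (m<n⇒m%n≡m u₀<) (m*n%n≡0 i (suc α₀))) (+-identityʳ u₀))) u₀<))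
  (trans (cong₂ _+_ (m<n⇒m/n≡0 u₀<) (m*n/n≡m i (suc α₀))) refl))
  where
  u₀< : u₀ < suc α₀
  u₀< = u≤

parentFst-child : ∀ i u α₀ → 1 ≤ u → u ≤ suc α₀ → parentFst (childFst i u (suc α₀)) (childSnd i u (suc α₀)) ≡ u
parentFst-child i u α₀ p q rewrite childIndex-child i u α₀ p q | parentSnd-child i u (suc α₀) =
    m+n∸n≡m u (i * suc α₀)

cong₃ : ∀ (f : ℕ → ℕ → ℕ → ℕ) {a a' b b' c c'} → a ≡ a' → b ≡ b' → c ≡ c' → f a b c ≡ f a' b' c'
cong₃ f refl refl refl = refl

record Parent (u' α' : ℕ) : Set where
  field
    childFst-parent : childFst (childIndex u' α') (parentFst u' α') (parentSnd u' α') ≡ u'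
    childSnd-parent : childSnd (childIndex u' α') (parentFst u' α') (parentSnd u' α') ≡ α'
    parentFst≥1 : 1 ≤ parentFst u' α'
    parentFst≤parentSnd : parentFst u' α' ≤ parentSnd u' α'
    parentSnd< : parentSnd u' α' < α'

parent : ∀ u' α' → 1 ≤ u' → u' < α' → Parent u' α'
parent (suc u₀) α' _ lt with m≤n⇒∃[o]m+o≡n lt
... | d₀ , refl = record { childFst-parent = cu-eq ; childSnd-parent = ca-eq ; parentFst≥1 = pu1 ;
    parentFst≤parentSnd = pul ; parentSnd< = pdl }
  where
  d = suc d₀
  pdE : parentSnd (suc u₀) (suc (suc u₀) + d₀) ≡ d
  pdE = trans (cong (_∸ suc u₀) (sym (+-suc (suc u₀) d₀))) (m+n∸m≡n (suc u₀) d)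
  i = u₀ / d
  ρ = u₀ % d
  piE : childIndex (suc u₀) (suc (suc u₀) + d₀) ≡ i
  piE = cong (λ x → u₀ / suc (x ∸ 1)) pdE
  u₀E : u₀ ≡ ρ + i * d
  u₀E = m≡m%n+[m/n]*n u₀ d
  puE : parentFst (suc u₀) (suc (suc u₀) + d₀) ≡ suc ρ
  puE = trans (cong₂ (λ a b → suc u₀ ∸ a * b) piE pdE)
      (trans (cong (λ x → suc x ∸ i * d) u₀E)
      (trans (+-∸-assoc 1 (m≤n+m (i * d) ρ)) (cong suc (m+n∸n≡m ρ (i * d)))))
  cu-eq : childFst (childIndex (suc u₀) (suc (suc u₀) + d₀))
      (parentFst (suc u₀) (suc (suc u₀) + d₀)) (parentSnd (suc u₀) (suc (suc u₀) + d₀)) ≡ suc u₀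
  cu-eq = trans (cong₃ childFst piE puE pdE) (cong suc (sym u₀E))
  ca-eq : childSnd (childIndex (suc u₀) (suc (suc u₀) + d₀))
      (parentFst (suc u₀) (suc (suc u₀) + d₀)) (parentSnd (suc u₀) (suc (suc u₀) + d₀)) ≡ suc (suc u₀) + d₀
  ca-eq = trans (cong₃ childSnd piE puE pdE)
      (trans (cong suc (lem ρ (i * d) d₀)) (cong (λ x → suc (suc x + d₀)) (sym u₀E)))
    where
    lem : ∀ a b c → a + (suc c + b) ≡ suc (a + b + c)
    lem = solve-∀
  pu1 : 1 ≤ parentFst (suc u₀) (suc (suc u₀) + d₀)
  pu1 = subst (1 ≤_) (sym puE) (s≤s z≤n)
  pul : parentFst (suc u₀) (suc (suc u₀) + d₀) ≤ parentSnd (suc u₀) (suc (suc u₀) + d₀)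
  pul = subst₂ _≤_ (sym puE) (sym pdE) (m%n<n u₀ d)
  pdl : parentSnd (suc u₀) (suc (suc u₀) + d₀) < suc (suc u₀) + d₀
  pdl = subst (_< suc (suc u₀) + d₀) (sym pdE) (s≤s (s≤s (m≤n+m d₀ u₀)))

gcd[m+n,n]≡gcd[m,n] : ∀ a b → gcd (a + b) b ≡ gcd a b
gcd[m+n,n]≡gcd[m,n] a b = ∣-antisym
  (gcd-greatest (∣m+n∣m⇒∣n (subst (gcd (a + b) b ∣_) (+-comm a b) (gcd[m,n]∣m (a + b) b))
      (gcd[m,n]∣n (a + b) b)) (gcd[m,n]∣n (a + b) b))
  (gcd-greatest (∣m∣n⇒∣m+n (gcd[m,n]∣m a b) (gcd[m,n]∣n a b)) (gcd[m,n]∣n a b))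

gcd[m+i*n,n]≡gcd[m,n] : ∀ a i b → gcd (a + i * b) b ≡ gcd a b
gcd[m+i*n,n]≡gcd[m,n] a zero b = cong (λ x → gcd x b) (+-identityʳ a)
gcd[m+i*n,n]≡gcd[m,n] a (suc i) b = trans (cong (λ x → gcd x b) (lem a b (i * b)))
    (trans (gcd[m+n,n]≡gcd[m,n] (a + i * b) b) (gcd[m+i*n,n]≡gcd[m,n] a i b))
  where
  lem : ∀ a b c → a + (b + c) ≡ a + c + b
  lem = solve-∀

gcd[m,n+m]≡gcd[m,n] : ∀ a b → gcd a (b + a) ≡ gcd a b
gcd[m,n+m]≡gcd[m,n] a b = trans (gcd-comm a (b + a)) (trans (gcd[m+n,n]≡gcd[m,n] b a) (gcd-comm b a))

gcd-parent : ∀ u' α' → 1 ≤ u' → u' < α' → gcd (parentFst u' α') (parentSnd u' α') ≡ gcd u' α'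
gcd-parent u' α' p q = trans (sym (gcd[m+i*n,n]≡gcd[m,n] (parentFst u' α') (childIndex u' α') (parentSnd u' α')))
  (trans (cong (λ x → gcd x (parentSnd u' α')) (Parent.childFst-parent P))
      (trans (sym (gcd[m,n+m]≡gcd[m,n] u' (parentSnd u' α'))) (cong (gcd u') e)))
  where
  P = parent u' α' p q
  e : parentSnd u' α' + u' ≡ α'
  e = trans (cong (parentSnd u' α' +_) (sym (Parent.childFst-parent P)))
      (trans (lem (parentFst u' α') (childIndex u' α') (parentSnd u' α')) (Parent.childSnd-parent P))
    where
    lem : ∀ a i d → d + (a + i * d) ≡ a + suc i * d
    lem = solve-∀

≡²? : ∀ a b c d → Dec (a ≡ c × b ≡ d)
≡²? a b c d with a ≟ c | b ≟ d
... | yes p | yes q = yes (p , q)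
... | no ¬p | _ = no (¬p ∘ proj₁)
... | yes _ | no ¬q = no (¬q ∘ proj₂)

edgeCost : ℕ → ℕ → ℕ
edgeCost u α = 2 * suc (childIndex u α)

-- pathSum f M N r h = h (r ∸ c) when N is an ancestor of M and the edge costs c along the
-- path from M up to N add up to at most r; otherwise 0.
pathSum : ℕ → ℕ → ℕ → ℕ → ℕ → ℕ → (ℕ → ℕ) → ℕ
pathSum zero uM αM uN αN r h = 0
pathSum (suc f) uM αM uN αN r h =
  if does (≡²? uM αM uN αN) then h r
  else (if does (αM ≤? αN) then 0
  else (if does (edgeCost uM αM ≤? r) then pathSum f (parentFst uM αM) (parentSnd uM αM) uN αN
      (r ∸ edgeCost uM αM) h else 0))

pathSum-here : ∀ f u α r h → pathSum (suc f) u α u α r h ≡ h r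
pathSum-here f u α r h = if-yes (≡²? u α u α) _ _ (refl , refl)

pathSum-≤ : ∀ f uM αM uN αN r h → ¬ (uM ≡ uN × αM ≡ αN) → αM ≤ αN → pathSum f uM αM uN αN r h ≡ 0
pathSum-≤ zero uM αM uN αN r h ne le = refl
pathSum-≤ (suc f) uM αM uN αN r h ne le = trans (if-no (≡²? uM αM uN αN) _ _ ne) (if-yes (αM ≤? αN) 0 _ le)

pathSum-step : ∀ f uM αM uN αN r h → ¬ (uM ≡ uN × αM ≡ αN) → αN < αM →
  pathSum (suc f) uM αM uN αN r h ≡
      (if does (edgeCost uM αM ≤? r) then pathSum f (parentFst uM αM) (parentSnd uM αM) uN αN
      (r ∸ edgeCost uM αM) h else 0)
pathSum-step f uM αM uN αN r h ne lt = trans (if-no (≡²? uM αM uN αN) _ _ ne) (if-no (αM ≤? αN) 0 _ (<⇒≱ lt))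

pathSum-< : ∀ f uM αM uN αN r h → αM < αN → pathSum f uM αM uN αN r h ≡ 0
pathSum-< f uM αM uN αN r h lt = pathSum-≤ f uM αM uN αN r h (λ e → <-irrefl (proj₂ e) lt) (<⇒≤ lt)

gcd[n,n]≡n : ∀ n → gcd n n ≡ n
gcd[n,n]≡n n = ∣-antisym (gcd[m,n]∣m n n) (gcd-greatest ∣-refl ∣-refl)

childSnd> : ∀ i u α → 1 ≤ u → α < childSnd i u α
childSnd> i u α p = <-≤-trans (m<n+m α p) (+-monoʳ-≤ u (m≤m+n α (i * α)))

∸-swap-≤ : ∀ x y r → 1 ≤ x → x ≤ r ∸ y → y ≤ r ∸ x
∸-swap-≤ x y r p q = m+n≤o⇒m≤o∸n y
    (subst (_≤ r) (+-comm x y) (m≤o∸n⇒m+n≤o x (<⇒≤ (m∸n≢0⇒n<m λ e → <-irrefl (sym e) (≤-trans p q) )) q))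

childPathSum : ℕ → ℕ → ℕ → ℕ → ℕ → ℕ → ℕ → (ℕ → ℕ) → ℕ → ℕ
childPathSum k f uM αM uN αN r h i = if does (childFst i uN αN + childSnd i uN αN ≤? k) then
    pathSum f uM αM (childFst i uN αN) (childSnd i uN αN) (r ∸ 2 * suc i) h else 0

child⇒parent : ∀ i uN αN uM αM → 1 ≤ uN → uN ≤ αN → (uM ≡ childFst i uN αN × αM ≡ childSnd i uN αN) →
  parentFst uM αM ≡ uN × parentSnd uM αM ≡ αN × childIndex uM αM ≡ i
child⇒parent i uN (suc α₀) uM αM p q (refl , refl) =
  parentFst-child i uN α₀ p q , parentSnd-child i uN (suc α₀) , childIndex-child i uN α₀ p q
child⇒parent i uN zero uM αM p q _ = ⊥-elim (<-irrefl refl (≤-trans p q))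

childPathSum-≤ : ∀ k f uM αM uN αN r h i → 1 ≤ uN → αM ≤ αN → childPathSum k f uM αM uN αN r h i ≡ 0
childPathSum-≤ k f uM αM uN αN r h i p le = if-case (childFst i uN αN + childSnd i uN αN ≤? k)
    (λ _ → pathSum-< f uM αM _ _ _ h (≤-<-trans le (childSnd> i uN αN p))) (λ _ → refl)

∸-swap : ∀ r a b → r ∸ a ∸ b ≡ r ∸ b ∸ a
∸-swap r a b = trans (∸-+-assoc r a b) (trans (cong (r ∸_) (+-comm a b)) (sym (∸-+-assoc r b a)))

module PathSumStep (k f uM αM uN αN r : ℕ) (h : ℕ → ℕ)
  (uM≥1 : 1 ≤ uM) (uM<αM : uM < αM) (actM : uM + αM ≤ k) (uN≥1 : 1 ≤ uN) (uN≤αN : uN ≤ αN) where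

  P : Parent uM αM
  P = parent uM αM uM≥1 uM<αM

  c : ℕ
  c = edgeCost uM αM

  T : ℕ → ℕ
  T i = if does (childFst i uN αN + childSnd i uN αN ≤? k) then
      (if does (c ≤? r ∸ 2 * suc i) then pathSum f (parentFst uM αM) (parentSnd uM αM)
      (childFst i uN αN) (childSnd i uN αN) (r ∸ 2 * suc i ∸ c) h else 0) else 0

  E : ℕ → ℕ
  E i = if does (≡²? uM αM (childFst i uN αN) (childSnd i uN αN)) then h (r ∸ c) else 0

  c-child : ∀ i → (uM ≡ childFst i uN αN × αM ≡ childSnd i uN αN) → c ≡ 2 * suc i
  c-child i e = cong (λ x → 2 * suc x) (proj₂ (proj₂ (child⇒parent i uN αN uM αM uN≥1 uN≤αN e)))

  childPathSum-split : ∀ i → i < ⌊ r /2⌋ → childPathSum k (suc f) uM αM uN αN r h i ≡ T i + E i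
  childPathSum-split i lt = dec-elim (≡²? uM αM (childFst i uN αN) (childSnd i uN αN))
      (λ e → trans (yesC e)
      (cong (T i +_) (sym (if-yes (≡²? uM αM (childFst i uN αN) (childSnd i uN αN)) _ 0 e))))
      (λ e → trans (noC e) (cong (T i +_) (sym (if-no (≡²? uM αM (childFst i uN αN) (childSnd i uN αN)) _ 0 e))))
    where
    yesC : (uM ≡ childFst i uN αN × αM ≡ childSnd i uN αN) →
      childPathSum k (suc f) uM αM uN αN r h i ≡ T i + h (r ∸ c)
    yesC e = trans ctE (sym (trans (cong (_+ h (r ∸ c)) tZ) refl))
      where
      cp = child⇒parent i uN αN uM αM uN≥1 uN≤αN e
      actC : childFst i uN αN + childSnd i uN αN ≤ k
      actC = subst₂ (λ a b → a + b ≤ k) (proj₁ e) (proj₂ e) actM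
      ctE : childPathSum k (suc f) uM αM uN αN r h i ≡ h (r ∸ c)
      ctE = trans (if-yes (childFst i uN αN + childSnd i uN αN ≤? k) _ 0 actC)
              (trans (subst₂ (λ a b → pathSum (suc f) a b (childFst i uN αN) (childSnd i uN αN)
                  (r ∸ 2 * suc i) h ≡ h (r ∸ 2 * suc i)) (sym (proj₁ e)) (sym (proj₂ e))
                  (pathSum-here f (childFst i uN αN) (childSnd i uN αN) (r ∸ 2 * suc i) h))
                     (cong (λ x → h (r ∸ x)) (sym (c-child i e))))
      tZ : T i ≡ 0
      tZ = if-case (childFst i uN αN + childSnd i uN αN ≤? k)
             (λ _ → if-case (c ≤? r ∸ 2 * suc i)
                (λ _ → subst₂ (λ a b → pathSum f a b (childFst i uN αN) (childSnd i uN αN)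
                    (r ∸ 2 * suc i ∸ c) h ≡ 0) (sym (proj₁ cp)) (sym (proj₁ (proj₂ cp)))
                    (pathSum-< f uN αN _ _ _ h (childSnd> i uN αN uN≥1)))
                (λ _ → refl))
             (λ _ → refl)
    noC : ¬ (uM ≡ childFst i uN αN × αM ≡ childSnd i uN αN) → childPathSum k (suc f) uM αM uN αN r h i ≡ T i + 0
    noC ne' = trans (dec-elim (αM ≤? childSnd i uN αN) leC gtC) (sym (+-identityʳ (T i)))
      where
      leC : αM ≤ childSnd i uN αN → childPathSum k (suc f) uM αM uN αN r h i ≡ T i
      leC le = trans (if-case (childFst i uN αN + childSnd i uN αN ≤? k)
          (λ _ → pathSum-≤ (suc f) uM αM _ _ _ h ne' le) (λ _ → refl))
                 (sym (if-case (childFst i uN αN + childSnd i uN αN ≤? k)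
                   (λ _ → if-case (c ≤? r ∸ 2 * suc i)
                       (λ _ → pathSum-< f _ _ _ _ _ h (<-≤-trans (Parent.parentSnd< P) le)) (λ _ → refl))
                   (λ _ → refl)))
      gtC : ¬ (αM ≤ childSnd i uN αN) → childPathSum k (suc f) uM αM uN αN r h i ≡ T i
      gtC nle = if-case (childFst i uN αN + childSnd i uN αN ≤? k)
                  (λ a → trans (pathSum-step f uM αM _ _ _ h ne' (≰⇒> nle))
                      (sym (if-yes (childFst i uN αN + childSnd i uN αN ≤? k) _ 0 a)))
                  (λ a → sym (if-no (childFst i uN αN + childSnd i uN αN ≤? k) _ 0 a))

  c≥1 : 1 ≤ c
  c≥1 = s≤s z≤n

  E0 : ∀ i → ¬ (uM ≡ childFst i uN αN × αM ≡ childSnd i uN αN) → E i ≡ 0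
  E0 i ne' = if-no (≡²? uM αM (childFst i uN αN) (childSnd i uN αN)) _ 0 ne'

  ΣE : c ≤ r → Σ< ⌊ r /2⌋ E ≡ (if does (≡²? (parentFst uM αM) (parentSnd uM αM) uN αN) then h (r ∸ c) else 0)
  ΣE c≤r = dec-elim (≡²? (parentFst uM αM) (parentSnd uM αM) uN αN) yP nP
    where
    i0 = childIndex uM αM
    yP : (parentFst uM αM ≡ uN × parentSnd uM αM ≡ αN) → Σ< ⌊ r /2⌋ E ≡
        (if does (≡²? (parentFst uM αM) (parentSnd uM αM) uN αN) then h (r ∸ c) else 0)
    yP e = trans (Σ-single ⌊ r /2⌋ E i0 (2*suc≤⇒<⌊n/2⌋ r i0 c≤r)
        (λ i _ ne'' → E0 i (λ e' → ne'' (sym (proj₂ (proj₂ (child⇒parent i uN αN uM αM uN≥1 uN≤αN e')))))))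
             (trans (if-yes (≡²? uM αM (childFst i0 uN αN) (childSnd i0 uN αN)) _ 0 mc)
                 (sym (if-yes (≡²? (parentFst uM αM) (parentSnd uM αM) uN αN) _ 0 e)))
      where
      mc : uM ≡ childFst i0 uN αN × αM ≡ childSnd i0 uN αN
      mc = trans (sym (Parent.childFst-parent P)) (cong₂ (childFst i0) (proj₁ e) (proj₂ e))
         , trans (sym (Parent.childSnd-parent P)) (cong₂ (childSnd i0) (proj₁ e) (proj₂ e))
    nP : ¬ (parentFst uM αM ≡ uN × parentSnd uM αM ≡ αN) → Σ< ⌊ r /2⌋ E ≡
        (if does (≡²? (parentFst uM αM) (parentSnd uM αM) uN αN) then h (r ∸ c) else 0)
    nP ne'' = trans (Σ-zero ⌊ r /2⌋
        (λ i _ → E0 i (λ e' → ne''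
        (let cp = child⇒parent i uN αN uM αM uN≥1 uN≤αN e' in proj₁ cp , proj₁ (proj₂ cp)))))
                (sym (if-no (≡²? (parentFst uM αM) (parentSnd uM αM) uN αN) _ 0 ne''))

  ΣT : c ≤ r → Σ< ⌊ r /2⌋ T ≡ Σ< ⌊ r ∸ c /2⌋ (childPathSum k f (parentFst uM αM) (parentSnd uM αM) uN αN (r ∸ c) h)
  ΣT c≤r = trans (Σ-trunc ⌊ r ∸ c /2⌋ ⌊ r /2⌋ T (⌊n/2⌋-mono (m∸n≤m r c)) zeroT) (Σ-cong ⌊ r ∸ c /2⌋ eqT)
    where
    zeroT : ∀ i → ⌊ r ∸ c /2⌋ ≤ i → i < ⌊ r /2⌋ → T i ≡ 0
    zeroT i p _ = if-case (childFst i uN αN + childSnd i uN αN ≤? k)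
      (λ _ → if-no (c ≤? r ∸ 2 * suc i) _ 0
          (λ q → <⇒≱ (2*suc≤⇒<⌊n/2⌋ (r ∸ c) i (∸-swap-≤ c (2 * suc i) r c≥1 q)) p))
      (λ _ → refl)
    eqT : ∀ i → i < ⌊ r ∸ c /2⌋ → T i ≡ childPathSum k f (parentFst uM αM) (parentSnd uM αM) uN αN (r ∸ c) h i
    eqT i p = cong (λ x → if does (childFst i uN αN + childSnd i uN αN ≤? k) then x else 0)
      (trans (if-yes (c ≤? r ∸ 2 * suc i) _ 0 (∸-swap-≤ (2 * suc i) c r (s≤s z≤n) (<⌊n/2⌋⇒2*suc≤ (r ∸ c) i p)))
             (cong (λ y → pathSum f (parentFst uM αM) (parentSnd uM αM) (childFst i uN αN)
                 (childSnd i uN αN) y h) (∸-swap r (2 * suc i) c)))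

  case-le : c ≤ r → Σ< ⌊ r /2⌋ (childPathSum k (suc f) uM αM uN αN r h)
    ≡ (if does (≡²? (parentFst uM αM) (parentSnd uM αM) uN αN) then h (r ∸ c) else 0)
      + Σ< ⌊ r ∸ c /2⌋ (childPathSum k f (parentFst uM αM) (parentSnd uM αM) uN αN (r ∸ c) h)
  case-le c≤r = trans (Σ-cong ⌊ r /2⌋ childPathSum-split)
      (trans (Σ-distrib-+ ⌊ r /2⌋ T E)
      (trans (+-comm (Σ< ⌊ r /2⌋ T) (Σ< ⌊ r /2⌋ E)) (cong₂ _+_ (ΣE c≤r) (ΣT c≤r))))

  case-gt : ¬ (c ≤ r) → Σ< ⌊ r /2⌋ (childPathSum k (suc f) uM αM uN αN r h) ≡ 0
  case-gt nc = Σ-zero ⌊ r /2⌋ (λ i p → trans (childPathSum-split i p) (cong₂ _+_ (tz i p) (ez i p)))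
    where
    tz : ∀ i → i < ⌊ r /2⌋ → T i ≡ 0
    tz i p = if-case (childFst i uN αN + childSnd i uN αN ≤? k)
        (λ _ → if-no (c ≤? r ∸ 2 * suc i) _ 0 (λ q → nc (≤-trans q (m∸n≤m r (2 * suc i))))) (λ _ → refl)
    ez : ∀ i → i < ⌊ r /2⌋ → E i ≡ 0
    ez i p = E0 i (λ e → nc (subst (_≤ r) (sym (c-child i e)) (<⌊n/2⌋⇒2*suc≤ r i p)))

pathSum-unfold : ∀ k f uM αM uN αN r (h : ℕ → ℕ) → 1 ≤ uM → uM ≤ αM → gcd uM αM ≡ 1 → uM + αM ≤ k →
    αM ≤ f → 1 ≤ uN → uN ≤ αN →
  pathSum f uM αM uN αN r h
    ≡ (if does (≡²? uM αM uN αN) then h r else 0) + Σ< ⌊ r /2⌋ (childPathSum k f uM αM uN αN r h)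
pathSum-unfold k zero uM αM uN αN r h uM≥1 uM≤αM g1 act αM≤f uN≥1 uN≤αN = ⊥-elim (<⇒≱ (≤-trans uM≥1 uM≤αM) αM≤f)
pathSum-unfold k (suc f) uM αM uN αN r h uM≥1 uM≤αM g1 act αM≤f uN≥1 uN≤αN = dec-elim (≡²? uM αM uN αN) yesE noE
  where
  Goal : Set
  Goal = pathSum (suc f) uM αM uN αN r h
    ≡ (if does (≡²? uM αM uN αN) then h r else 0) + Σ< ⌊ r /2⌋ (childPathSum k (suc f) uM αM uN αN r h)
  RHSsum0 : αM ≤ αN → Σ< ⌊ r /2⌋ (childPathSum k (suc f) uM αM uN αN r h) ≡ 0
  RHSsum0 le = Σ-zero ⌊ r /2⌋ (λ i _ → childPathSum-≤ k (suc f) uM αM uN αN r h i uN≥1 le)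
  yesE : (uM ≡ uN × αM ≡ αN) → Goal
  yesE e = trans (subst₂ (λ a b → pathSum (suc f) a b uN αN r h ≡ h r) (sym (proj₁ e))
      (sym (proj₂ e)) (pathSum-here f uN αN r h))
             (sym (trans (cong₂ _+_ (if-yes (≡²? uM αM uN αN) _ 0 e)
                 (RHSsum0 (≤-reflexive (proj₂ e)))) (+-identityʳ _)))
  noE : ¬ (uM ≡ uN × αM ≡ αN) → Goal
  noE ne = dec-elim (αM ≤? αN) leE gtE
    where
    rhs0 : (if does (≡²? uM αM uN αN) then h r else 0) ≡ 0
    rhs0 = if-no (≡²? uM αM uN αN) _ 0 ne
    leE : αM ≤ αN → Goal
    leE le = trans (pathSum-≤ (suc f) uM αM uN αN r h ne le) (sym (trans (cong₂ _+_ rhs0 (RHSsum0 le)) refl))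
    gtE : ¬ (αM ≤ αN) → Goal
    gtE nle = dec-elim (edgeCost uM αM ≤? r) cle cgt
      where
      lt : αN < αM
      lt = ≰⇒> nle
      uM<αM : uM < αM
      uM<αM = ≤∧≢⇒< uM≤αM (λ e → <⇒≱ (≤-<-trans (≤-trans uN≥1 uN≤αN) lt)
          (≤-reflexive (trans (sym e) (trans (sym (gcd[n,n]≡n uM)) (trans (cong (gcd uM) e) g1)))))
      Pr : Parent uM αM
      Pr = parent uM αM uM≥1 uM<αM
      open PathSumStep k f uM αM uN αN r h uM≥1 uM<αM act uN≥1 uN≤αN using (case-le; case-gt)
      pu≤uM : parentFst uM αM ≤ uM
      pu≤uM = subst (parentFst uM αM ≤_) (Parent.childFst-parent Pr) (m≤m+n _ _)
      IH : ∀ r' → pathSum f (parentFst uM αM) (parentSnd uM αM) uN αN r' h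
        ≡ (if does (≡²? (parentFst uM αM) (parentSnd uM αM) uN αN) then h r' else 0)
          + Σ< ⌊ r' /2⌋ (childPathSum k f (parentFst uM αM) (parentSnd uM αM) uN αN r' h)
      IH r' = pathSum-unfold k f (parentFst uM αM) (parentSnd uM αM) uN αN r' h
          (Parent.parentFst≥1 Pr) (Parent.parentFst≤parentSnd Pr) (trans (gcd-parent uM αM uM≥1 uM<αM) g1)
               (≤-trans (+-mono-≤ pu≤uM (<⇒≤ (Parent.parentSnd< Pr))) act)
                   (≤-pred (<-≤-trans (Parent.parentSnd< Pr) αM≤f)) uN≥1 uN≤αN
      cle : edgeCost uM αM ≤ r → Goal
      cle c≤r = trans (pathSum-step f uM αM uN αN r h ne lt)
          (trans (if-yes (edgeCost uM αM ≤? r) _ 0 c≤r)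
          (trans (IH (r ∸ edgeCost uM αM))
          (sym (trans (cong (_+ Σ< ⌊ r /2⌋ (childPathSum k (suc f) uM αM uN αN r h)) rhs0) (case-le c≤r)))))
      cgt : ¬ (edgeCost uM αM ≤ r) → Goal
      cgt nc = trans (pathSum-step f uM αM uN αN r h ne lt)
          (trans (if-no (edgeCost uM αM ≤? r) _ 0 nc) (sym (trans (cong₂ _+_ rhs0 (case-gt nc)) refl)))

-- Flattening the recursion along the tree

-- Sum over 1 ≤ u ≤ α ≤ k.
Σpairs : ℕ → (ℕ → ℕ → ℕ) → ℕ
Σpairs k F = Σ< k (λ a → Σ< (suc a) (λ b → F (suc b) (suc a)))

Σpairs-cong : ∀ k {F G : ℕ → ℕ → ℕ} → (∀ u α → 1 ≤ u → u ≤ α → α ≤ k → F u α ≡ G u α) → Σpairs k F ≡ Σpairs k G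
Σpairs-cong k h = Σ-cong k (λ a p → Σ-cong (suc a) (λ b q → h (suc b) (suc a) (s≤s z≤n) q p))

Σpairs-distrib-+ : ∀ k (F G : ℕ → ℕ → ℕ) → Σpairs k (λ u α → F u α + G u α) ≡ Σpairs k F + Σpairs k G
Σpairs-distrib-+ k F G = trans (Σ-cong k (λ a _ → Σ-distrib-+ (suc a) _ _)) (Σ-distrib-+ k _ _)

Σpairs-zero : ∀ k (F : ℕ → ℕ → ℕ) → (∀ u α → 1 ≤ u → u ≤ α → α ≤ k → F u α ≡ 0) → Σpairs k F ≡ 0
Σpairs-zero k F h = trans (Σpairs-cong k h) (Σ-zero k (λ a _ → Σ-zero (suc a) (λ _ _ → refl)))

Σ-Σpairs-comm : ∀ k n (F : ℕ → ℕ → ℕ → ℕ) →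
  Σ< n (λ i → Σpairs k (λ u α → F i u α)) ≡ Σpairs k (λ u α → Σ< n (λ i → F i u α))
Σ-Σpairs-comm k n F = trans (Σ-comm n k _) (Σ-cong k (λ a _ → Σ-comm n (suc a) _))

Σpairs-single : ∀ k (F : ℕ → ℕ → ℕ) u0 α0 → 1 ≤ u0 → u0 ≤ α0 → α0 ≤ k →
  Σpairs k (λ u α → if does (≡²? u α u0 α0) then F u α else 0) ≡ F u0 α0
Σpairs-single k F (suc b0) (suc a0) _ (s≤s b0≤a0) a0<k =
  trans (Σ-single k _ a0 a0<k
      (λ a _ ne → Σ-zero (suc a)
      (λ b _ → if-no (≡²? (suc b) (suc a) (suc b0) (suc a0)) _ 0 (λ e → ne (suc-injective (proj₂ e))))))
   (trans (Σ-single (suc a0) _ b0 (s≤s b0≤a0)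
       (λ b _ ne → if-no (≡²? (suc b) (suc a0) (suc b0) (suc a0)) _ 0 (λ e → ne (suc-injective (proj₁ e)))))
     (if-yes (≡²? (suc b0) (suc a0) (suc b0) (suc a0)) _ 0 (refl , refl)))

child-coprime : ∀ i u α → 1 ≤ u → u ≤ α → gcd u α ≡ 1 →
  1 ≤ childFst i u α × childFst i u α ≤ childSnd i u α × gcd (childFst i u α) (childSnd i u α) ≡ 1
child-coprime i u zero p q g = ⊥-elim (<⇒≱ (≤-trans p q) ≤-refl)
child-coprime i u (suc α₀) p q g = ≤-trans p (m≤m+n u _) , c≤ , trans
    (sym (gcd-parent _ _ (≤-trans p (m≤m+n u _)) c<))
    (trans (cong₂ gcd (parentFst-child i u α₀ p q) (parentSnd-child i u (suc α₀))) g)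
  where
  c< : childFst i u (suc α₀) < childSnd i u (suc α₀)
  c< = +-monoʳ-< u (subst (i * suc α₀ <_) (sym refl) (m<n+m (i * suc α₀) (s≤s z≤n)))
  c≤ : childFst i u (suc α₀) ≤ childSnd i u (suc α₀)
  c≤ = <⇒≤ c<

-- Unfolding K along the tree, every pair contributes its non-recursive summands ownWeight at the
-- remaining rank at which the recursion reaches it. Children with u + α > k stay inside
-- ownWeight, so that only the finitely many pairs with u + α ≤ k occur.
module Flatten (k : ℕ) where
  admissible? : (u α : ℕ) → Dec (gcd u α ≡ 1 × u + α ≤ k)
  admissible? u α = (gcd u α ≟ 1) ×-dec (u + α ≤? k)

  ownWeight : ℕ → ℕ → ℕ → ℕ
  ownWeight u α s = K-base s u α k
    + Σ< ⌊ s /2⌋ (λ i → if does (childFst i u α + childSnd i u α ≤? k) then 0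
                         else K (s ∸ 2 * suc i) (childFst i u α) (childSnd i u α) k)
    + Σ< ⌊ s ∸ 2 /2⌋ (λ i → K-cut K s u α k (suc i))

  activePart : ℕ → ℕ → ℕ → ℕ
  activePart u α s = Σ< ⌊ s /2⌋ (λ i → if does (childFst i u α + childSnd i u α ≤? k)
    then K (s ∸ 2 * suc i) (childFst i u α) (childSnd i u α) k else 0)

  K-split : ∀ s u α → K s u α k ≡ ownWeight u α s + activePart u α s
  K-split s u α = trans (K-unfold s u α k)
      (trans (cong (λ x → K-base s u α k + x + Σ< ⌊ s ∸ 2 /2⌋ (λ i → K-cut K s u α k (suc i)))
      (trans (Σ-cong ⌊ s /2⌋
      (λ i _ → split-if (does (childFst i u α + childSnd i u α ≤? k)) (Kc i)))
      (Σ-distrib-+ ⌊ s /2⌋ St Ac)))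
      (rearr (K-base s u α k) (Σ< ⌊ s /2⌋ St) (Σ< ⌊ s /2⌋ Ac) (Σ< ⌊ s ∸ 2 /2⌋ (λ i → K-cut K s u α k (suc i)))))
    where
    Kc : ℕ → ℕ
    Kc i = K (s ∸ 2 * suc i) (childFst i u α) (childSnd i u α) k
    St : ℕ → ℕ
    St i = if does (childFst i u α + childSnd i u α ≤? k) then 0 else Kc i
    Ac : ℕ → ℕ
    Ac i = if does (childFst i u α + childSnd i u α ≤? k) then Kc i else 0
    rearr : ∀ a b c d → a + (b + c) + d ≡ a + b + d + c
    rearr = solve-∀

  Flattened : ℕ → Set
  Flattened r = ∀ uN αN → 1 ≤ uN → uN ≤ αN → gcd uN αN ≡ 1 → uN + αN ≤ k →
    K r uN αN k ≡ Σpairs k (λ u α → if does (admissible? u α) then pathSum k u α uN αN r (ownWeight u α) else 0)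

  ownWeight≡Σpairs : ∀ r uN αN → 1 ≤ uN → uN ≤ αN → gcd uN αN ≡ 1 → uN + αN ≤ k →
    ownWeight uN αN r
    ≡ Σpairs k (λ u α → if does (admissible? u α) then (if does (≡²? u α uN αN) then ownWeight u α r else 0) else 0)
  ownWeight≡Σpairs r uN αN uN≥1 uN≤αN g1 act = trans (sym (trans
      (Σpairs-single k (λ u α → if does (admissible? u α) then ownWeight u α r else 0) uN αN uN≥1
        uN≤αN (≤-trans (m≤n+m αN uN) act))
      (if-yes (admissible? uN αN) _ 0 (g1 , act))))
    (Σpairs-cong k (λ u α _ _ _ → if-if-comm (does (≡²? u α uN αN)) (does (admissible? u α)) (ownWeight u α r)))

  pathSum-unfold-admissible : ∀ r uN αN → 1 ≤ uN → uN ≤ αN → ∀ u α → 1 ≤ u → u ≤ α → α ≤ k →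
    (if does (admissible? u α) then (if does (≡²? u α uN αN) then ownWeight u α r else 0) else 0)
      + (if does (admissible? u α) then Σ< ⌊ r /2⌋ (childPathSum k k u α uN αN r (ownWeight u α)) else 0)
    ≡ (if does (admissible? u α) then pathSum k u α uN αN r (ownWeight u α) else 0)
  pathSum-unfold-admissible r uN αN uN≥1 uN≤αN u α p q α≤k = trans
      (if-+ (does (admissible? u α)) (if does (≡²? u α uN αN) then ownWeight u α r else 0)
      (Σ< ⌊ r /2⌋ (childPathSum k k u α uN αN r (ownWeight u α)))) (if-case (admissible? u α)
    (λ v → trans (sym (pathSum-unfold k k u α uN αN r (ownWeight u α) p q (proj₁ v) (proj₂ v) α≤k
        uN≥1 uN≤αN)) (sym (if-yes (admissible? u α) _ 0 v)))
    (λ v → sym (if-no (admissible? u α) _ 0 v)))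

  flatten-step : ∀ r → (∀ r' → r' < r → Flattened r') → Flattened r
  flatten-step r rec uN αN uN≥1 uN≤αN g1 act = trans (K-split r uN αN)
      (trans (cong₂ _+_ (ownWeight≡Σpairs r uN αN uN≥1 uN≤αN g1 act) actE)
        (trans (sym (Σpairs-distrib-+ k Fw Fa)) (Σpairs-cong k (pathSum-unfold-admissible r uN αN uN≥1 uN≤αN))))
    where
    Fw : ℕ → ℕ → ℕ
    Fw u α = if does (admissible? u α) then (if does (≡²? u α uN αN) then ownWeight u α r else 0) else 0
    Fa : ℕ → ℕ → ℕ
    Fa u α = if does (admissible? u α) then Σ< ⌊ r /2⌋ (childPathSum k k u α uN αN r (ownWeight u α)) else 0
    actE : activePart uN αN r ≡ Σpairs k
        (λ u α → if does (admissible? u α) then Σ< ⌊ r /2⌋ (childPathSum k k u α uN αN r (ownWeight u α)) else 0)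
    actE = trans (Σ-cong ⌊ r /2⌋ (λ i p → Ai i p))
        (trans (Σ-Σpairs-comm k ⌊ r /2⌋
        (λ i u α → if does (admissible? u α) then childPathSum k k u α uN αN r (ownWeight u α) i
        else 0)) (Σpairs-cong k
        (λ u α _ _ _ → if-Σ (does (admissible? u α)) ⌊ r /2⌋ (childPathSum k k u α uN αN r (ownWeight u α)))))
      where
      Ai : ∀ i → i < ⌊ r /2⌋ →
          (if does (childFst i uN αN + childSnd i uN αN ≤? k) then K (r ∸ 2 * suc i)
          (childFst i uN αN) (childSnd i uN αN) k else 0)
                             ≡ Σpairs k (λ u α → if does (admissible? u α) then childPathSum k k u
                                 α uN αN r (ownWeight u α) i else 0)
      Ai i p = if-case (childFst i uN αN + childSnd i uN αN ≤? k) ya na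
        where
        cv = child-coprime i uN αN uN≥1 uN≤αN g1
        ya : childFst i uN αN + childSnd i uN αN ≤ k → K (r ∸ 2 * suc i) (childFst i uN αN)
            (childSnd i uN αN) k ≡ Σpairs k
            (λ u α → if does (admissible? u α) then childPathSum k k u α uN αN r (ownWeight u α) i else 0)
        ya a = (trans (rec (r ∸ 2 * suc i) (∸-< r (2 * suc i) (s≤s z≤n) (<⌊n/2⌋⇒2*suc≤ r i p))
            (childFst i uN αN) (childSnd i uN αN) (proj₁ cv) (proj₁ (proj₂ cv)) (proj₂ (proj₂ cv)) a)
            (Σpairs-cong k (λ u α _ _ _ → cong (λ x → if does (admissible? u α) then x else 0)
                (sym (if-yes (childFst i uN αN + childSnd i uN αN ≤? k)
                (pathSum k u α (childFst i uN αN) (childSnd i uN αN) (r ∸ 2 * suc i) (ownWeight u α)) 0 a)))))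
        na : ¬ (childFst i uN αN + childSnd i uN αN ≤ k) → 0 ≡ Σpairs k
            (λ u α → if does (admissible? u α) then childPathSum k k u α uN αN r (ownWeight u α) i else 0)
        na a = sym (Σpairs-zero k
            (λ u α → if does (admissible? u α) then childPathSum k k u α uN αN r (ownWeight u α) i
            else 0) (λ u α _ _ _ → if-case (admissible? u α)
            (λ _ → if-no (childFst i uN αN + childSnd i uN αN ≤? k)
            (pathSum k u α (childFst i uN αN) (childSnd i uN αN) (r ∸ 2 * suc i) (ownWeight u α)) 0
            a) (λ _ → refl)))
  flatten : ∀ f r → r ≤ f → Flattened r
  flatten zero r le = flatten-step r (λ r' lt → ⊥-elim (<⇒≱ (<-≤-trans lt le) z≤n))
  flatten (suc f) r le = flatten-step r (λ r' lt → flatten f r' (≤-pred (<-≤-trans lt le)))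

depth : ℕ → ℕ → ℕ → ℕ
depth zero u α = 0
depth (suc f) u α = if does (≡²? u α 1 1) then 0 else edgeCost u α + depth f (parentFst u α) (parentSnd u α)

coprime-root : ∀ u α → 1 ≤ u → u ≤ α → gcd u α ≡ 1 → α ≤ 1 → u ≡ 1 × α ≡ 1
coprime-root (suc zero) (suc zero) _ _ _ _ = refl , refl
coprime-root (suc (suc u)) α _ (s≤s (s≤s q)) _ (s≤s ())
coprime-root (suc zero) (suc (suc α)) _ _ _ (s≤s ())
coprime-root zero α () _ _ _

coprime-< : ∀ u α → 1 ≤ u → u ≤ α → gcd u α ≡ 1 → 1 < α → u < α
coprime-< u α p q g lt = ≤∧≢⇒< q
    (λ e → <-irrefl (trans (sym (trans (sym (gcd[n,n]≡n u)) (trans (cong (gcd u) e) g))) e) lt)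

if-if-∸ : ∀ c x r (h : ℕ → ℕ) →
    (if does (c ≤? r) then (if does (x ≤? r ∸ c) then h (r ∸ c ∸ x) else 0) else 0) ≡
    (if does (c + x ≤? r) then h (r ∸ (c + x)) else 0)
if-if-∸ c x r h = dec-elim (c ≤? r)
  (λ p → trans (if-yes (c ≤? r) _ 0 p) (dec-elim (x ≤? r ∸ c)
     (λ q → trans (if-yes (x ≤? r ∸ c) _ 0 q)
         (trans (cong h (∸-+-assoc r c x))
         (sym (if-yes (c + x ≤? r) _ 0 (subst (_≤ r) (+-comm x c) (m≤o∸n⇒m+n≤o x p q))))))
     (λ q → trans (if-no (x ≤? r ∸ c) _ 0 q)
         (sym (if-no (c + x ≤? r) _ 0 (λ z → q (m+n≤o⇒m≤o∸n x (subst (_≤ r) (+-comm c x) z))))))))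
  (λ p → trans (if-no (c ≤? r) _ 0 p) (sym (if-no (c + x ≤? r) _ 0 (λ z → p (≤-trans (m≤m+n c x) z)))))

pathSum-root : ∀ f u α r (h : ℕ → ℕ) → 1 ≤ u → u ≤ α → gcd u α ≡ 1 → α ≤ f →
  pathSum f u α 1 1 r h ≡ (if does (depth f u α ≤? r) then h (r ∸ depth f u α) else 0)
pathSum-root zero u α r h p q g le = ⊥-elim (<⇒≱ (≤-trans p q) le)
pathSum-root (suc f) u α r h p q g le = dec-elim (≡²? u α 1 1) isRoot notRoot
  where
  Goal : Set
  Goal = pathSum (suc f) u α 1 1 r h ≡ (if does (depth (suc f) u α ≤? r) then h (r ∸ depth (suc f) u α) else 0)
  isRoot : (u ≡ 1 × α ≡ 1) → Goal
  isRoot e = subst₂ (λ a b → pathSum (suc f) a b 1 1 r h ≡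
      (if does (depth (suc f) a b ≤? r) then h (r ∸ depth (suc f) a b) else 0)) (sym (proj₁ e)) (sym (proj₂ e))
               (trans (pathSum-here f 1 1 r h) (sym (if-yes (0 ≤? r) _ 0 z≤n)))
  notRoot : ¬ (u ≡ 1 × α ≡ 1) → Goal
  notRoot ne = trans (pathSum-step f u α 1 1 r h ne α>1)
    (trans (cong (λ x → if does (edgeCost u α ≤? r) then x else 0)
        (pathSum-root f (parentFst u α) (parentSnd u α) (r ∸ edgeCost u α) h
        (Parent.parentFst≥1 Pr) (Parent.parentFst≤parentSnd Pr) (trans (gcd-parent u α p u<α) g)
        (≤-pred (<-≤-trans (Parent.parentSnd< Pr) le))))
    (trans (if-if-∸ (edgeCost u α) (depth f (parentFst u α) (parentSnd u α)) r h)
      (cong (λ x → if does (x ≤? r) then h (r ∸ x) else 0) (sym (if-no (≡²? u α 1 1) 0 _ ne)))))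
    where
    α>1 : 1 < α
    α>1 = ≰⇒> (λ z → ne (coprime-root u α p q g z))
    u<α : u < α
    u<α = coprime-< u α p q g α>1
    Pr = parent u α p u<α

depth-bound : ∀ f u α → 1 ≤ u → u ≤ α → gcd u α ≡ 1 → α ≤ f → depth f u α + 2 ≤ 2 * α
depth-bound zero u α p q g le = ⊥-elim (<⇒≱ (≤-trans p q) le)
depth-bound (suc f) u α p q g le = dec-elim (≡²? u α 1 1) atRoot belowRoot
  where
  atRoot : u ≡ 1 × α ≡ 1 → depth (suc f) u α + 2 ≤ 2 * α
  atRoot e = subst (λ x → x + 2 ≤ 2 * α) (sym (if-yes (≡²? u α 1 1) 0 _ e))
    (subst (λ a → 2 ≤ 2 * a) (sym (proj₂ e)) ≤-refl)
  belowRoot : ¬ (u ≡ 1 × α ≡ 1) → depth (suc f) u α + 2 ≤ 2 * α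
  belowRoot ne = subst (λ x → x + 2 ≤ 2 * α) (sym (if-no (≡²? u α 1 1) 0 _ ne)) bound
    where
    open ≤-Reasoning
    u<α = coprime-< u α p q g (≰⇒> (λ z → ne (coprime-root u α p q g z)))
    Pr = parent u α p u<α
    i = childIndex u α
    d = depth f (parentFst u α) (parentSnd u α)
    IH : d + 2 ≤ 2 * parentSnd u α
    IH = depth-bound f (parentFst u α) (parentSnd u α) (Parent.parentFst≥1 Pr)
      (Parent.parentFst≤parentSnd Pr) (trans (gcd-parent u α p u<α) g)
      (≤-pred (<-≤-trans (Parent.parentSnd< Pr) le))
    key : suc i + parentSnd u α ≤ α
    key = subst (suc i + parentSnd u α ≤_) (Parent.childSnd-parent Pr)
      (childSnd-lower (parentFst u α) (parentSnd u α) i (Parent.parentFst≥1 Pr)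
        (≤-trans (Parent.parentFst≥1 Pr) (Parent.parentFst≤parentSnd Pr)))
    bound : edgeCost u α + d + 2 ≤ 2 * α
    bound = begin
      2 * suc i + d + 2          ≡⟨ +-assoc (2 * suc i) d 2 ⟩
      2 * suc i + (d + 2)        ≤⟨ +-monoʳ-≤ (2 * suc i) IH ⟩
      2 * suc i + 2 * parentSnd u α ≡⟨ *-distribˡ-+ 2 (suc i) (parentSnd u α) ⟨
      2 * (suc i + parentSnd u α) ≤⟨ *-monoʳ-≤ 2 key ⟩
      2 * α                      ∎

stable⇒2*suc+2≤ : ∀ i α k s → suc i + α ≤ k → 2 * k + 2 ≤ s + 2 * α → 2 * suc i + 2 ≤ s
stable⇒2*suc+2≤ i α k s A B = +-cancelʳ-≤ (2 * α) _ _
    (≤-trans (≤-reflexive (eq i α)) (≤-trans (+-monoˡ-≤ 2 (*-monoʳ-≤ 2 A)) B))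
  where
  eq : ∀ i α → 2 * suc i + 2 + 2 * α ≡ 2 * (suc i + α) + 2
  eq = solve-∀

m+n≤m*n : ∀ m q → 2 ≤ m → 2 ≤ q → m + q ≤ m * q
m+n≤m*n (suc (suc m₀)) (suc (suc q₀)) _ _ = subst (suc (suc m₀) + suc (suc q₀) ≤_) (sym (eq m₀ q₀)) (m≤m+n _ _)
  where
  eq : ∀ m₀ q₀ → suc (suc m₀) * suc (suc q₀) ≡ suc (suc m₀) + suc (suc q₀) + (m₀ + q₀ + m₀ * q₀)
  eq = solve-∀
m+n≤m*n (suc zero) q (s≤s ()) _
m+n≤m*n zero q () _
m+n≤m*n (suc (suc m)) (suc zero) _ (s≤s ())
m+n≤m*n (suc (suc m)) zero _ ()

stable⇒cut-room : ∀ m q i α k s → 2 ≤ m → 2 ≤ q → suc i + α ≤ q → k ≡ m * q → 2 * k + 2 ≤ s + 2 * α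
    → 2 * m ≤ s ∸ suc (2 * suc i)
stable⇒cut-room m q i α k s m2 q2 A e B = m+n≤o⇒m≤o∸n (2 * m) (≤-trans (n≤1+n _) step)
  where
  k≥ : m + (suc i + α) ≤ k
  k≥ = ≤-trans (+-monoʳ-≤ m A) (≤-trans (m+n≤m*n m q m2 q2) (≤-reflexive (sym e)))
  step : suc (2 * m + suc (2 * suc i)) ≤ s
  step = +-cancelʳ-≤ (2 * α) _ _ (≤-trans (≤-reflexive (eq m i α)) (≤-trans (+-monoˡ-≤ 2 (*-monoʳ-≤ 2 k≥)) B))
    where
    eq : ∀ m i α → suc (2 * m + suc (2 * suc i)) + 2 * α ≡ 2 * (m + (suc i + α)) + 2
    eq = solve-∀

quotient-self : ∀ k → 1 ≤ k → quotient k k ≡ 1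
quotient-self (suc k₀) _ = n/n≡1 (suc k₀)

K-one : ∀ x → 1 ≤ x → K x 1 1 1 ≡ 1
K-one (suc x) _ = K-small (suc x) (suc x) ≤-refl 1 1 1 ≤-refl ≤-refl (s≤s (s≤s z≤n))

∣⇒≤′ : ∀ q k → 1 ≤ k → q ∣ k → q ≤ k
∣⇒≤′ q (suc k₀) _ d = ∣⇒≤ d

-- Unfolding Ψ and φ

Ψ-body : ℕ → ℕ → ℕ
Ψ-body f k = Σ< (suc k ∸ 2) (λ i → if does ((2 + i) ∣? k) then Ψ-fuel f (k / suc (suc i)) * φ (2 + i) else 0)

Ψ-fuel-unfold : ∀ f k → k ≢ 1 → Ψ-fuel (suc f) k ≡ Ψ-body f k
Ψ-fuel-unfold f k ne with k ≟ 1
... | yes e = ⊥-elim (ne e)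
... | no _ = sum-map-range (λ r → if does (r ∣? k) then Ψ-fuel f (k / suc (r ∸ 1)) * φ r else 0) 2 (suc k)

Ψ-fuel-irrelevant : ∀ f f' k → k ≤ f → k ≤ f' → Ψ-fuel f k ≡ Ψ-fuel f' k
Ψ-fuel-irrelevant zero zero k _ _ = refl
Ψ-fuel-irrelevant zero (suc f') zero _ _ = sym (Ψ-fuel-unfold f' 0 (λ ()))
Ψ-fuel-irrelevant (suc f) zero zero _ _ = Ψ-fuel-unfold f 0 (λ ())
Ψ-fuel-irrelevant zero (suc f') (suc k) () _
Ψ-fuel-irrelevant (suc f) zero (suc k) _ ()
Ψ-fuel-irrelevant (suc f) (suc f') k le le' = dec-elim (k ≟ 1)
  (λ e → subst (λ x → Ψ-fuel (suc f) x ≡ Ψ-fuel (suc f') x) (sym e) refl)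
  (λ ne → trans (Ψ-fuel-unfold f k ne)
      (trans (Σ-cong (suc k ∸ 2)
      (λ i _ → if-cong ((2 + i) ∣? k)
      (λ _ → cong (_* φ (2 + i)) (Ψ-fuel-irrelevant f f' _ (bnd k i f le) (bnd k i f' le')))))
      (sym (Ψ-fuel-unfold f' k ne))))
  where
  bnd : ∀ k i g → k ≤ suc g → k / suc (suc i) ≤ g
  bnd zero i g l = z≤n
  bnd (suc k') i g l = ≤-pred (<-≤-trans (m/n<m (suc k') (suc (suc i)) (s≤s (s≤s z≤n))) l)

Ψ-unfold : ∀ k → 2 ≤ k → Ψ k ≡ Σ< (k ∸ 1)
    (λ i → if does ((2 + i) ∣? k) then Ψ (k / suc (suc i)) * φ (2 + i) else 0)
Ψ-unfold (suc k') k2 = trans (Ψ-fuel-unfold k' (suc k') (λ e → <-irrefl (sym e) k2))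
  (Σ-cong k' (λ i _ → if-cong ((2 + i) ∣? suc k')
      (λ d → cong (_* φ (2 + i)) (Ψ-fuel-irrelevant k' _ _ (bnd d) ≤-refl))))
  where
  bnd : ∀ {i} → (2 + i) ∣ suc k' → suc k' / suc (suc i) ≤ k'
  bnd {i} _ = ≤-pred (m/n<m (suc k') (suc (suc i)) (s≤s (s≤s z≤n)))

φ-unfold : ∀ q → φ q ≡ Σ< q (λ i → 𝟙 (does (gcd (1 + i) q ≟ 1)))
φ-unfold q = length-filter-range (λ i → gcd i q ≟ 1) 1 (suc q)

-- The stable range and the summation over pairs

K≡2Ψ-below : ℕ → Set
K≡2Ψ-below k = ∀ k' → 2 ≤ k' → k' < k → ∀ r → 2 * k' ≤ r → K r 1 1 k' ≡ 2 * Ψ k'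

divisorWeight : ℕ → ℕ → ℕ
divisorWeight k q = if does (q ∣? k) then 2 * Ψ (quotient k q) else 0

-- Once s + 2 α ≥ 2 k + 2, no summand of ownWeight u α s is cut off by the rank s, and it collapses
-- to Σ_i divisorWeight k (u + (i + 1) α), independently of s.
module StableWeight (k : ℕ) (k2 : 2 ≤ k)
  (IHK : K≡2Ψ-below k)
  (u α s : ℕ) (u1 : 1 ≤ u) (uα : u ≤ α) (act : u + α ≤ k) (stab : 2 * k + 2 ≤ s + 2 * α) where

  α1 : 1 ≤ α
  α1 = ≤-trans u1 uα

  k1 : 1 ≤ k
  k1 = ≤-trans (s≤s z≤n) k2

  q : ℕ → ℕ
  q i = u + suc i * α

  W : ℕ → ℕ
  W i = divisorWeight k (q i)

  u<k : u < k
  u<k = <-≤-trans (m<m+n u α1) act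

  div≤ : ∀ i → q i ∣ k → q i ≤ k
  div≤ i d = ∣⇒≤′ (q i) k k1 d

  qk-bounds : ∀ i → q i ≤ k → i < k × 2 * suc i + 2 ≤ s
  qk-bounds i le = <-≤-trans (≤-trans (s≤s (m≤m+n i α)) ≤-refl) A , stable⇒2*suc+2≤ i α k s A stab
    where
    A : suc i + α ≤ k
    A = ≤-trans (childSnd-lower u α i u1 α1) le

  cutTerm : ℕ → ℕ
  cutTerm i = K-cut K s u α k (suc i)

  Σ-cutTerm : Σ< ⌊ s ∸ 2 /2⌋ cutTerm ≡ Σ< k cutTerm
  Σ-cutTerm = Σ-support ⌊ s ∸ 2 /2⌋ k cutTerm (λ i nz → dec-elim (q i ∣? k)
          (λ d → let b = qk-bounds i (div≤ i d) in 2*suc≤⇒<⌊n/2⌋ (s ∸ 2) i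
              (m+n≤o⇒m≤o∸n (2 * suc i) (proj₂ b)) , proj₁ b)
          (λ nd → ⊥-elim (nz (if-no (q i ∣? k) _ 0 nd))))

  stopTerm : ℕ → ℕ
  stopTerm i = if does (childFst i u α + childSnd i u α ≤? k) then 0 else K (s ∸ 2 * suc i)
      (childFst i u α) (childSnd i u α) k

  stopTerm′ : ℕ → ℕ
  stopTerm′ i = pointMass (s ∸ 2 * suc (suc i)) (q i) k

  ca≥1 : ∀ i → 1 ≤ childSnd i u α
  ca≥1 i = ≤-trans u1 (m≤m+n u _)

  stopTerm-suc : ∀ i → stopTerm (suc i) ≡ stopTerm′ i
  stopTerm-suc i = if-case (childFst (suc i) u α + childSnd (suc i) u α ≤? k)
    (λ a → sym (pointMass-≢ (s ∸ 2 * suc (suc i)) (q i) k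
        (λ e → <-irrefl e (<-≤-trans (m<m+n (q i) (ca≥1 (suc i))) a))))
    (λ na → K-small (s ∸ 2 * suc (suc i)) (s ∸ 2 * suc (suc i)) ≤-refl (q i) (childSnd (suc i) u α)
        k k1 (ca≥1 (suc i)) (≰⇒> na))

  stopTerm-0 : stopTerm 0 ≡ 0
  stopTerm-0 = if-case (childFst 0 u α + childSnd 0 u α ≤? k) (λ _ → refl)
    (λ na → trans (K-small (s ∸ 2) (s ∸ 2) ≤-refl (childFst 0 u α) (childSnd 0 u α) k k1 (ca≥1 0)
        (≰⇒> na)) (pointMass-≢ (s ∸ 2) (childFst 0 u α) k (λ e → <-irrefl (trans (sym (+-identityʳ u)) e) u<k)))

  s4 : 4 ≤ s
  s4 = +-cancelʳ-≤ (2 * α) _ _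
      (≤-trans (≤-reflexive (eq α)) (≤-trans (+-monoˡ-≤ 2 (*-monoʳ-≤ 2 (≤-trans (+-monoˡ-≤ α u1) act))) stab))
    where
    eq : ∀ α → 4 + 2 * α ≡ 2 * (1 + α) + 2
    eq = solve-∀

  ⌊s/2⌋≥1 : 1 ≤ ⌊ s /2⌋
  ⌊s/2⌋≥1 = 2*suc≤⇒<⌊n/2⌋ s 0 (≤-trans (s≤s (s≤s z≤n)) s4)

  Σ-stopTerm : Σ< ⌊ s /2⌋ stopTerm ≡ Σ< k stopTerm′
  Σ-stopTerm = trans (Σ-head⁺ ⌊ s /2⌋ stopTerm ⌊s/2⌋≥1)
      (trans (cong (_+ Σ< (⌊ s /2⌋ ∸ 1) (λ i → stopTerm (suc i))) stopTerm-0)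
          (trans (Σ-cong (⌊ s /2⌋ ∸ 1) (λ i _ → stopTerm-suc i)) (Σ-support (⌊ s /2⌋ ∸ 1) k stopTerm′ nz)))
    where
    nz : ∀ i → stopTerm′ i ≢ 0 → i < ⌊ s /2⌋ ∸ 1 × i < k
    nz i ne = dec-elim (q i ≟ k)
      (λ e → let b = qk-bounds i (≤-reflexive e) in
             m+n≤o⇒m≤o∸n (suc i) (subst (_≤ ⌊ s /2⌋) (+-comm 1 (suc i))
                 (2*suc≤⇒<⌊n/2⌋ s (suc i) (subst (_≤ s) (eq i) (proj₂ b)))) , proj₁ b)
      (λ nq → ⊥-elim (ne (pointMass-≢ (s ∸ 2 * suc (suc i)) (q i) k nq)))
      where
      eq : ∀ i → 2 * suc i + 2 ≡ 2 * suc (suc i)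
      eq = solve-∀

  baseTerm : ℕ → ℕ
  baseTerm i = if does (⌊ s ∸ 1 /2⌋ ≟ suc i) then 𝟙 (does (q i ≟ k)) else 0

  𝟙-spread : ∀ H → 1 ≤ H → 𝟙 (does (u + α * H ≟ k)) ≡ Σ< k
      (λ i → if does (H ≟ suc i) then 𝟙 (does (q i ≟ k)) else 0)
  𝟙-spread (suc h') _ = dec-elim (h' <? k)
    (λ lt → sym (trans (Σ-single k _ h' lt
        (λ i _ ne → if-no (suc h' ≟ suc i) _ 0 (λ e → ne (sym (suc-injective e)))))
                   (trans (if-yes (suc h' ≟ suc h') _ 0 refl)
                       (cong (λ x → 𝟙 (does (u + x ≟ k))) (sym (*-comm α (suc h')))))))
    (λ nlt → trans (𝟙-> _ k (<-≤-trans (s≤s (≮⇒≥ nlt)) (≤-trans (≤-trans (α*suc≥' α h' α1) ≤-refl) (m≤n+m _ u))))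
                   (sym (Σ-zero k (λ i p → if-no (suc h' ≟ suc i) _ 0
                       (λ e → nlt (subst (_< k) (sym (suc-injective e)) p))))))
    where
    α*suc≥' : ∀ α h → 1 ≤ α → suc h ≤ α * suc h
    α*suc≥' α h p = subst (_≤ α * suc h) (*-identityˡ (suc h)) (*-monoˡ-≤ (suc h) p)

  K-base-suc : ∀ s → 1 ≤ s → K-base s u α k ≡ 𝟙 (does (u + α * ⌊ s ∸ 1 /2⌋ ≟ k))
  K-base-suc (suc s') _ = refl

  Σ-baseTerm : K-base s u α k ≡ Σ< k baseTerm
  Σ-baseTerm = trans (K-base-suc s (≤-trans (s≤s z≤n) s4))
      (𝟙-spread ⌊ s ∸ 1 /2⌋ (⌊n/2⌋-mono {2} {s ∸ 1} (m+n≤o⇒m≤o∸n 2 (≤-trans (s≤s (s≤s (s≤s z≤n))) s4))))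

  pointMass+base≡1 : ∀ i → 2 * suc (suc i) ≤ s → pointMass (s ∸ 2 * suc (suc i)) k k +
      (if does (⌊ s ∸ 1 /2⌋ ≟ suc i) then 𝟙 (does (k ≟ k)) else 0) ≡ 1
  pointMass+base≡1 i le with m≤n⇒∃[o]m+o≡n le
  ... | t , e = go t (trans (cong (_∸ 2 * suc (suc i)) (sym e)) (m+n∸m≡n (2 * suc (suc i)) t))
      (trans (cong (_∸ 1) (sym e)) (cong (_+ t) (trans (cong (_∸ 1) (2*suc (suc i))) refl)))
    where
    kk : 𝟙 (does (k ≟ k)) ≡ 1
    kk = 𝟙-yes (k ≟ k) refl
    go : ∀ t → s ∸ 2 * suc (suc i) ≡ t → s ∸ 1 ≡ suc (2 * suc i) + t → pointMass
        (s ∸ 2 * suc (suc i)) k k + (if does (⌊ s ∸ 1 /2⌋ ≟ suc i) then 𝟙 (does (k ≟ k)) else 0) ≡ 1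
    go zero e1 e2 = trans
        (cong₂ _+_ (cong (λ x → pointMass x k k) e1)
        (cong (λ x → if does (x ≟ suc i) then 𝟙 (does (k ≟ k)) else 0)
        (trans (cong ⌊_/2⌋ (trans e2 (+-identityʳ _))) (⌊1+2*n/2⌋≡n (suc i)))))
                      (trans (if-yes (suc i ≟ suc i) _ 0 refl) kk)
    go (suc t') e1 e2 = trans
        (cong₂ _+_ (trans (cong (λ x → pointMass x k k) e1) kk)
        (trans (cong (λ x → if does (⌊ x /2⌋ ≟ suc i) then 𝟙 (does (k ≟ k)) else 0) e2)
        (if-no (⌊ suc (2 * suc i) + suc t' /2⌋ ≟ suc i) _ 0 ne))) refl
      where
      ne : ⌊ suc (2 * suc i) + suc t' /2⌋ ≢ suc i
      ne e = <-irrefl refl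
          (≤-trans (subst (suc (suc i) ≤_) e
          (subst (λ x → suc (suc i) ≤ ⌊ x /2⌋) (sym (lem i t'))
          (≤-trans (≤-reflexive (sym (⌊2*n/2⌋≡n (suc (suc i))))) (⌊n/2⌋-mono (m≤m+n _ t'))))) ≤-refl)
        where
        lem : ∀ i t' → suc (2 * suc i) + suc t' ≡ 2 * suc (suc i) + t'
        lem = solve-∀

  k≡quotient*q : ∀ q' → 1 ≤ q' → q' ∣ k → k ≡ quotient k q' * q'
  k≡quotient*q (suc q₀) _ (divides c e) = trans e
      (cong (_* suc q₀) (sym (trans (cong (_/ suc q₀) e) (m*n/n≡m c (suc q₀)))))

  2≤cofactor : ∀ m q' → k ≡ m * q' → q' ≢ k → 2 ≤ m
  2≤cofactor zero q' e _ = ⊥-elim (<⇒≱ k2 (≤-trans (≤-reflexive e) z≤n))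
  2≤cofactor (suc zero) q' e ne = ⊥-elim (ne (sym (trans e (+-identityʳ q'))))
  2≤cofactor (suc (suc m)) q' e ne = s≤s (s≤s z≤n)

  m<m*2 : ∀ m → 2 ≤ m → m < m * 2
  m<m*2 m p = subst (m <_) (sym (trans (*-comm m 2) (cong (m +_) (+-identityʳ m)))) (m<m+n m (≤-trans (s≤s z≤n) p))

  terms≡W-∤ : ∀ i → ¬ (q i ∣ k) → cutTerm i + stopTerm′ i + baseTerm i ≡ W i
  terms≡W-∤ i nd = trans
      (cong₂ _+_ (cong₂ _+_ (if-no (q i ∣? k) _ 0 nd) (pointMass-≢ (s ∸ 2 * suc (suc i)) (q i) k ne))
        (if-case (⌊ s ∸ 1 /2⌋ ≟ suc i) (λ _ → 𝟙-no (q i ≟ k) ne) (λ _ → refl)))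
      (sym (if-no (q i ∣? k) _ 0 nd))
    where
    ne : q i ≢ k
    ne e = nd (subst (_∣ k) (sym e) ∣-refl)

  -- For q i = k the cut contributes K _ 1 1 1 = 1 and exactly one of the stop and base terms
  -- contributes 1: together 2 = 2 * Ψ 1.
  terms≡W-self : ∀ i → q i ≡ k → cutTerm i + stopTerm′ i + baseTerm i ≡ W i
  terms≡W-self i e = trans (+-assoc (cutTerm i) (stopTerm′ i) (baseTerm i))
      (trans (cong₂ _+_ cut1
        (subst (λ z → pointMass (s ∸ 2 * suc (suc i)) z k
                      + (if does (⌊ s ∸ 1 /2⌋ ≟ suc i) then 𝟙 (does (z ≟ k)) else 0) ≡ 1) (sym e)
          (pointMass+base≡1 i (subst (_≤ s) (eq2 i) (proj₂ b)))))
      (sym (trans (if-yes (q i ∣? k) _ 0 d) (cong (λ z → 2 * Ψ z) quotient≡1))))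
    where
    d : q i ∣ k
    d = subst (_∣ k) (sym e) ∣-refl
    b = qk-bounds i (≤-reflexive e)
    quotient≡1 : quotient k (q i) ≡ 1
    quotient≡1 = trans (cong (quotient k) e) (quotient-self k k1)
    cut1 : cutTerm i ≡ 1
    cut1 = trans (if-yes (q i ∣? k) _ 0 d)
      (trans (cong (K (s ∸ suc (2 * suc i)) 1 1) quotient≡1)
        (K-one _ (m+n≤o⇒m≤o∸n 1 (≤-trans (≤-reflexive (+-comm 2 (2 * suc i))) (proj₂ b)))))
    eq2 : ∀ i → 2 * suc i + 2 ≡ 2 * suc (suc i)
    eq2 = solve-∀

  terms≡W-proper : ∀ i → q i ∣ k → q i ≢ k → cutTerm i + stopTerm′ i + baseTerm i ≡ W i
  terms≡W-proper i d ne = trans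
      (cong₂ _+_
        (cong₂ _+_ (trans (if-yes (q i ∣? k) _ 0 d) (IHK m m2 m<k _ bound))
          (pointMass-≢ (s ∸ 2 * suc (suc i)) (q i) k ne))
        (if-case (⌊ s ∸ 1 /2⌋ ≟ suc i) (λ _ → 𝟙-no (q i ≟ k) ne) (λ _ → refl)))
      (trans (+-identityʳ _) (trans (+-identityʳ _) (sym (if-yes (q i ∣? k) _ 0 d))))
    where
    m = quotient k (q i)
    A : suc i + α ≤ q i
    A = childSnd-lower u α i u1 α1
    q2 : 2 ≤ q i
    q2 = ≤-trans (+-mono-≤ {1} {suc i} (s≤s z≤n) α1) A
    km : k ≡ m * q i
    km = k≡quotient*q (q i) (≤-trans (s≤s z≤n) q2) d
    m2 : 2 ≤ m
    m2 = 2≤cofactor m (q i) km ne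
    m<k : m < k
    m<k = <-≤-trans (m<m*2 m m2) (≤-trans (*-monoʳ-≤ m q2) (≤-reflexive (sym km)))
    bound : 2 * m ≤ s ∸ suc (2 * suc i)
    bound = stable⇒cut-room m (q i) i α k s m2 q2 A km stab

  terms≡W : ∀ i → cutTerm i + stopTerm′ i + baseTerm i ≡ W i
  terms≡W i = dec-elim (q i ∣? k) (λ d → dec-elim (q i ≟ k) (terms≡W-self i) (terms≡W-proper i d)) (terms≡W-∤ i)

  ownWeight-stable : Flatten.ownWeight k u α s ≡ Σ< k W
  ownWeight-stable = trans (cong₂ _+_ (cong₂ _+_ Σ-baseTerm Σ-stopTerm) Σ-cutTerm)
    (trans (rr (Σ< k baseTerm) (Σ< k stopTerm′) (Σ< k cutTerm))
    (trans (sym (trans (Σ-distrib-+ k (λ i → cutTerm i + stopTerm′ i) baseTerm)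
        (cong (_+ Σ< k baseTerm) (Σ-distrib-+ k cutTerm stopTerm′))))
    (Σ-cong k (λ i _ → terms≡W i))))
    where
    rr : ∀ a b c → a + b + c ≡ c + b + a
    rr = solve-∀

module PairSummation (k : ℕ) (k2 : 2 ≤ k) (IHK : K≡2Ψ-below k) where

  k1 : 1 ≤ k
  k1 = ≤-trans (s≤s z≤n) k2

  g : ℕ → ℕ
  g q = divisorWeight k q

  g-> : ∀ q → k < q → g q ≡ 0
  g-> q lt = if-no (q ∣? k) _ 0 (>⇒∤ q k k1 lt)

  coprimeBelow : ℕ → ℕ
  coprimeBelow q = Σ< k (λ a → if does (suc a <? q) then 𝟙 (does (gcd q (suc a) ≟ 1)) else 0)

  coprimeBelow≡φ : ∀ q → 2 ≤ q → q ≤ k → coprimeBelow q ≡ φ q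
  coprimeBelow≡φ (suc q') q2 qk = trans
      (Σ-trunc q' k _ (≤-trans (n≤1+n q') qk) (λ a p _ → if-no (suc a <? suc q') _ 0 (λ z → <⇒≱ (≤-pred z) p)))
    (trans (Σ-cong q' (λ a p → trans (if-yes (suc a <? suc q') _ 0 (s≤s p))
        (cong (λ x → 𝟙 (does (x ≟ 1))) (gcd-comm (suc q') (suc a)))))
    (sym (trans (φ-unfold (suc q'))
        (trans (cong (Σ< q' (λ i → 𝟙 (does (gcd (1 + i) (suc q') ≟ 1))) +_)
        (𝟙-no (gcd (suc q') (suc q') ≟ 1) ne)) (+-identityʳ _)))))
    where
    ne : gcd (suc q') (suc q') ≢ 1
    ne e = <-irrefl (trans (sym e) (gcd[n,n]≡n (suc q'))) q2

  Σdivisors≡2Ψ : Σ< (suc k) (λ q → g q * coprimeBelow q) ≡ 2 * Ψ k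
  Σdivisors≡2Ψ = trans (Σ-head k _)
      (trans (cong₂ _+_ f0
      (trans (Σ-head⁺ k (λ j → g (suc j) * coprimeBelow (suc j)) k1) (cong₂ _+_ f1 refl))) (sym main))
      where
      f : ℕ → ℕ
      f q = g q * coprimeBelow q
      f0 : f 0 ≡ 0
      f0 = cong (_* coprimeBelow 0) (if-no (0 ∣? k) _ 0 (λ d → <⇒≱ k1 (≤-reflexive (0∣⇒≡0' d))))
        where
        0∣⇒≡0' : 0 ∣ k → k ≡ 0
        0∣⇒≡0' (divides c eq) = trans eq (*-zeroʳ c)
      f1 : f 1 ≡ 0
      f1 = trans (cong (g 1 *_)
          (Σ-zero k (λ a _ → if-no (suc a <? 1) (𝟙 (does (gcd 1 (suc a) ≟ 1))) 0
          (λ z → <⇒≱ z (s≤s z≤n))))) (*-zeroʳ (g 1))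
      main : 2 * Ψ k ≡ 0 + (0 + Σ< (k ∸ 1) (λ j → f (2 + j)))
      main = trans (cong (2 *_) (Ψ-unfold k k2)) (trans (Σ-*ˡ (k ∸ 1) 2 _) (Σ-cong (k ∸ 1) (λ j p → pt j p)))
        where
        pt : ∀ j → j < k ∸ 1 → 2 * (if does ((2 + j) ∣? k) then Ψ (k / suc (suc j)) * φ (2 + j) else 0) ≡ f (2 + j)
        pt j p = trans (*-if 2 (does ((2 + j) ∣? k)) (Ψ (k / suc (suc j)) * φ (2 + j)))
                   (trans (if-cong ((2 + j) ∣? k)
                       (λ _ → trans (sym (*-assoc 2 (Ψ (k / suc (suc j))) (φ (2 + j))))
                       (cong ((2 * Ψ (k / suc (suc j))) *_)
                       (sym (coprimeBelow≡φ (2 + j) (s≤s (s≤s z≤n)) (bnd j p))))))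
                          (sym (if-* (does ((2 + j) ∣? k)) (2 * Ψ (k / suc (suc j))) (coprimeBelow (2 + j)))))
          where
          bnd : ∀ j → j < k ∸ 1 → 2 + j ≤ k
          bnd j p = subst (2 + j ≤_) (m+[n∸m]≡n k1) (s≤s p)

  flatTerm : ℕ → ℕ → ℕ → ℕ
  flatTerm r u α = if does (Flatten.admissible? k u α) then
      (if does (depth k u α ≤? r) then Flatten.ownWeight k u α (r ∸ depth k u α) else 0) else 0

  K≡Σpairs : ∀ r → K r 1 1 k ≡ Σpairs k (flatTerm r)
  K≡Σpairs r = trans (Flatten.flatten k r r ≤-refl 1 1 (s≤s z≤n) ≤-refl refl k2)
    (Σpairs-cong k (λ u α p q le → if-cong (Flatten.admissible? k u α) {c = 0}
        (λ v → pathSum-root k u α r (Flatten.ownWeight k u α) p q (proj₁ v) le)))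

  progressionTerm : ℕ → ℕ → ℕ
  progressionTerm u α = if does (gcd u α ≟ 1) then Σ< k (λ i → g (u + suc i * α)) else 0

  Σpairs-stable : ∀ r → 2 * k ≤ r → Σpairs k (flatTerm r) ≡ Σpairs k progressionTerm
  Σpairs-stable r r2k = Σpairs-cong k pt
    where
    pt : ∀ u α → 1 ≤ u → u ≤ α → α ≤ k → flatTerm r u α ≡ progressionTerm u α
    pt u α p q le = dec-elim (Flatten.admissible? k u α) yV nV
      where
      yV : (gcd u α ≡ 1 × u + α ≤ k) → flatTerm r u α ≡ progressionTerm u α
      yV v = trans (if-yes (Flatten.admissible? k u α) _ 0 v) (trans (if-yes (depth k u α ≤? r) _ 0 h≤r)
               (trans (StableWeight.ownWeight-stable k k2 IHK u α (r ∸ depth k u α) p q (proj₂ v)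
                   stab) (sym (if-yes (gcd u α ≟ 1) _ 0 (proj₁ v)))))
        where
        hb : depth k u α + 2 ≤ 2 * α
        hb = depth-bound k u α p q (proj₁ v) le
        h≤r : depth k u α ≤ r
        h≤r = ≤-trans (m≤m+n _ 2) (≤-trans hb (≤-trans (*-monoʳ-≤ 2 le) r2k))
        stab : 2 * k + 2 ≤ r ∸ depth k u α + 2 * α
        stab = ≤-trans (+-monoˡ-≤ 2 r2k)
            (≤-trans (≤-reflexive
            (sym (trans (sym (+-assoc (r ∸ depth k u α) (depth k u α) 2))
            (cong (_+ 2) (m∸n+n≡m h≤r))))) (+-monoʳ-≤ (r ∸ depth k u α) hb))
      nV : ¬ (gcd u α ≡ 1 × u + α ≤ k) → flatTerm r u α ≡ progressionTerm u α
      nV nv = trans (if-no (Flatten.admissible? k u α) _ 0 nv) (sym (if-case (gcd u α ≟ 1)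
                (λ g1 → Σ-zero k (λ i _ → g-> _ (<-≤-trans (≰⇒> (λ a → nv (g1 , a))) (+-monoʳ-≤ u (m≤m+n α _)))))
                (λ _ → refl)))

  coprimeTerm : ℕ → ℕ → ℕ
  coprimeTerm a q = if does (gcd q (suc a) ≟ 1) then g q else 0

  -- For fixed q, the coprime pairs u ≤ α < q with q ≡ u (mod α) correspond to the α < q that
  -- are coprime to q, which gives the factor φ q.
  Σpairs≡Σdivisors : Σpairs k progressionTerm ≡ Σ< (suc k) (λ q → g q * coprimeBelow q)
  Σpairs≡Σdivisors = trans (Σ-cong k row)
      (trans (Σ-comm k (suc k) (λ a q → if does (suc a <? q) then coprimeTerm a q else 0)) (Σ-cong (suc k) col))
    where
    row : ∀ a → a < k → Σ< (suc a) (λ b → progressionTerm (suc b) (suc a)) ≡ Σ< (suc k)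
        (λ q → if does (suc a <? q) then coprimeTerm a q else 0)
    row a a<k = trans (Σ-cong (suc a) (λ b _ → st1 b))
        (Σ-progressions k (suc a) (coprimeTerm a) (s≤s z≤n) a<k
        (λ q lt → if-case (gcd q (suc a) ≟ 1) (λ _ → g-> q lt) (λ _ → refl)))
      where
      st1 : ∀ b → progressionTerm (suc b) (suc a) ≡ Σ< k (λ i → coprimeTerm a (suc b + suc i * suc a))
      st1 b = trans (sym (if-Σ (does (gcd (suc b) (suc a) ≟ 1)) k (λ i → g (suc b + suc i * suc a))))
                (Σ-cong k (λ i _ → cong
                    (λ z → if does (z ≟ 1) then g (suc b + suc i * suc a) else 0)
                    (sym (gcd[m+i*n,n]≡gcd[m,n] (suc b) (suc i) (suc a)))))
    col : ∀ q → q < suc k → Σ< k (λ a → if does (suc a <? q) then coprimeTerm a q else 0) ≡ g q * coprimeBelow q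
    col q _ = trans (Σ-cong k (λ a _ → if-if-* (does (suc a <? q)) (does (gcd q (suc a) ≟ 1)) (g q)))
                (sym (Σ-*ˡ k (g q) (λ a → if does (suc a <? q) then 𝟙 (does (gcd q (suc a) ≟ 1)) else 0)))

  K≡2Ψ : ∀ r → 2 * k ≤ r → K r 1 1 k ≡ 2 * Ψ k
  K≡2Ψ r le = trans (K≡Σpairs r) (trans (Σpairs-stable r le) (trans Σpairs≡Σdivisors Σdivisors≡2Ψ))

K≡2Ψ-fuel : ∀ f k → k ≤ f → 2 ≤ k → ∀ r → 2 * k ≤ r → K r 1 1 k ≡ 2 * Ψ k
K≡2Ψ-fuel zero k le k2 = ⊥-elim (<⇒≱ k2 (≤-trans le z≤n))
K≡2Ψ-fuel (suc f) k le k2 = PairSummation.K≡2Ψ k k2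
    (λ k' k'2 k'<k → K≡2Ψ-fuel f k' (≤-pred (<-≤-trans k'<k le)) k'2)

K≡2Ψ : ∀ k → 2 ≤ k → ∀ r → 2 * k ≤ r → K r 1 1 k ≡ 2 * Ψ k
K≡2Ψ k = K≡2Ψ-fuel k k ≤-refl

L≡1 : ∀ r → 2 ≤ r → L r 1 ≡ 1
L≡1 (suc r) _ = trans (L≡K (suc r) (s≤s z≤n) 1)
    (K-small (suc r) (suc r) ≤-refl 1 1 1 ≤-refl ≤-refl (s≤s (s≤s z≤n)))

L≡2Ψ : ∀ k r → 1 < k → 2 * k ≤ r → L r k ≡ 2 * Ψ k
L≡2Ψ k r k2 le = trans
    (L≡K r (≤-trans (s≤s z≤n) (≤-trans (*-monoʳ-≤ 2 (≤-trans (s≤s z≤n) k2)) le)) k) (K≡2Ψ k k2 r le)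

L-stable : ∀ k r s → 1 ≤ k → 2 * k ≤ r → 2 * k ≤ s → L r k ≡ L s k
L-stable (suc zero) r s _ lr ls = trans (L≡1 r lr) (sym (L≡1 s ls))
L-stable (suc (suc k)) r s _ lr ls = trans (L≡2Ψ _ r (s≤s (s≤s z≤n)) lr) (sym (L≡2Ψ _ s (s≤s (s≤s z≤n)) ls))

theorem4p4 : ((k r s : ℕ) → 1 ≤ k → 2 * k ≤ r → 2 * k ≤ s → L r k ≡ L s k)
    × ((r : ℕ) → 2 ≤ r → L r 1 ≡ 1)
    × ((k r : ℕ) → 1 < k → 2 * k ≤ r → L r k ≡ 2 * Ψ k)
theorem4p4 = L-stable , L≡1 , L≡2Ψ
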